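{- For every $n\ge 4$, the number $|A^{3412}(n)|$ of alternating permutations $\sigma\in A_n$ with $\sigma_3<\sigma_4<\sigma_1<\sigma_2$ equals $2nE_{n-1}-3E_n$, i.e. $n!$ times the coefficient of $x^n$ in $(2x-3)(\sec x+\tan x)$.
   Context: A permutation $\sigma$ of $\{1,\dots,n\}$ is alternating if $\sigma_1<\sigma_2>\sigma_3<\sigma_4>\cdots$; $A_n$ is the set of such permutations. $E_n$ is the $n$-th Euler number, $\sum_{n\ge0}E_n\frac{x^n}{n!}=\sec x+\tan x$. -}

module Defs where

open import Data.Bool using (Bool; true; false; _∧_; if_then_else_; not)
open import Data.Nat as ℕ using (ℕ; zero; suc; _∸_; _<ᵇ_; _≡ᵇ_)
open import Data.Nat.Combinatorics using (_C_)
open import Data.Integer as ℤ using (ℤ; +_; -_; _+_; _-_; _*_)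
open import Data.Fin using (Fin; toℕ; fromℕ)
open import Data.Vec using (Vec; []; _∷ʳ_; lookup)
open import Data.List as L using (List; []; _∷_; length; filterᵇ; allFin; map; foldr; applyUpTo; concatMap)

-- Euler numbers, defined by  Σ E_n x^n / n! = sec x + tan x.
-- Equivalently (formal power series identity) E(x) · cos x = 1 + sin x.
-- Comparing n! · [x^n] of both sides:
--   Σ_{k=0}^{n} C(n,k) · E_k · cosC (n-k) = [n = 0] + sinC n,
-- where cosC m = m! [x^m] cos x and sinC m = m! [x^m] sin x.
-- Since cosC 0 = 1 this determines E_n recursively.

sign : ℕ → ℤ
sign zero          = + 1
sign (suc zero)    = - (+ 1)
sign (suc (suc j)) = sign j

cosC : ℕ → ℤ
cosC m = if ℕ._%_ m 2 ≡ᵇ 0 then sign (ℕ._/_ m 2) else + 0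

sinC : ℕ → ℤ
sinC m = if ℕ._%_ m 2 ≡ᵇ 1 then sign (ℕ._/_ m 2) else + 0

δ₀ : ℕ → ℤ
δ₀ zero    = + 1
δ₀ (suc _) = + 0

sumℤ : List ℤ → ℤ
sumℤ = foldr _+_ (+ 0)

eulerStep : (n : ℕ) → (Fin n → ℤ) → ℤ
eulerStep n e = δ₀ n + sinC n
  - sumℤ (map (λ k → (+ (n C toℕ k)) * e k * cosC (n ∸ toℕ k)) (allFin n))

eulerVec : (n : ℕ) → Vec ℤ n
eulerVec zero    = []
eulerVec (suc n) = eulerVec n ∷ʳ eulerStep n (lookup (eulerVec n))

E : ℕ → ℤ
E n = lookup (eulerVec (suc n)) (fromℕ n)

words : ℕ → ℕ → List (List ℕ)
words n zero    = [] ∷ []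
words n (suc k) = concatMap (λ w → map (λ a → a ∷ w) (applyUpTo suc n)) (words n k)

allᵇ : {A : Set} → (A → Bool) → List A → Bool
allᵇ p []       = true
allᵇ p (x ∷ xs) = p x ∧ allᵇ p xs

inRange : ℕ → ℕ → Bool
inRange n a = (0 <ᵇ a) ∧ (a <ᵇ suc n)

distinct : List ℕ → Bool
distinct []       = true
distinct (a ∷ as) = allᵇ (λ b → not (a ≡ᵇ b)) as ∧ distinct as

isPerm : ℕ → List ℕ → Bool
isPerm n σ = (length σ ≡ᵇ n) ∧ allᵇ (inRange n) σ ∧ distinct σ

mutual
  altUp : List ℕ → Bool
  altUp (a ∷ b ∷ r) = (a <ᵇ b) ∧ altDown (b ∷ r)
  altUp _           = true

  altDown : List ℕ → Bool
  altDown (a ∷ b ∷ r) = (b <ᵇ a) ∧ altUp (b ∷ r)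
  altDown _           = true

isAlternating : List ℕ → Bool
isAlternating = altUp

pattern3412 : List ℕ → Bool
pattern3412 (s1 ∷ s2 ∷ s3 ∷ s4 ∷ _) = (s3 <ᵇ s4) ∧ (s4 <ᵇ s1) ∧ (s1 <ᵇ s2)
pattern3412 _ = false

A3412 : ℕ → List (List ℕ)
A3412 n = filterᵇ (λ σ → isPerm n σ ∧ isAlternating σ ∧ pattern3412 σ) (words n n)

numA3412 : ℕ → ℕ
numA3412 n = length (A3412 n)

-- Build a permutation letter by letter: deleting the first letter a of σ ∈ Sₙ₊₁ and standardising
-- the rest (the inverse of punchIn a) turns a count over Sₙ₊₁ into a sum over a of counts over Sₙ.
-- For the numbers up n c and down n c of alternating permutations of {1, …, n} that start with c
-- and go up resp. down first, this gives the Entringer recurrences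
-- up (n+2) c = Σ_{h ≥ c} down (n+1) h and down (n+2) c = Σ_{h < c} up (n+1) h, and complementation
-- exchanges up and down. The array entringer m n = down (m+n+1) (n+1) obeys the boustrophedon
-- rule; so does its product with cos (x + y) and so does cos x + sin y, and both have first column
-- cos x. Hence entringer · cos (x + y) = cos x + sin y, whose restriction to x = 0 is the recurrence
-- defining E, so E n = down (n+1) (n+1).
-- Standardising the first four letters, σ ∈ A³⁴¹²(m+4) corresponds to ranks a ≤ b, c ≤ h, h + 1 < a
-- followed by a down-alternating permutation of {1, …, m+1} starting with h; hence
-- |A³⁴¹²(m+4)| = Σ_h h T(m+2-h) down (m+1) h with T the triangular numbers. Unwinding the
-- recurrences writes E (m+3) and E (m+4) over the same basis down (m+1) h, and the theorem becomes
-- a polynomial identity between the weights.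

{-# OPTIONS --safe #-}
module Submission where

open import Defs
open import Data.Bool using (Bool; true; false; _∧_; not)
open import Data.Bool.Properties using (∧-assoc; ∧-identityʳ; ∧-zeroʳ)
open import Data.Empty using (⊥-elim)
open import Data.Fin using (Fin; zero; suc; toℕ; fromℕ; inject₁)
open import Data.Fin.Properties using (toℕ-fromℕ; toℕ-inject₁)
open import Data.Fin.Relation.Unary.Top using (view; ‵fromℕ; ‵inject₁)
open import Data.Integer using (ℤ; +_; -_; _+_; _*_; _-_)
open import Data.Integer.Properties
import Algebra.Properties.CommutativeSemigroup as CommutativeSemigroupProperties
open CommutativeSemigroupProperties +-commutativeSemigroup using (interchange; x∙yz≈y∙xz; xy∙z≈xz∙y)
open CommutativeSemigroupProperties *-commutativeSemigroup
  using () renaming (x∙yz≈y∙xz to x*yz≡y*xz; x∙yz≈yx∙z to x*yz≡yx*z)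
open import Data.Integer.Tactic.RingSolver using (solve-∀)
open import Data.List using (List; []; _∷_; length; map; filterᵇ; applyUpTo; concatMap; _++_; tabulate; allFin)
open import Data.List.Properties using (filter-++; length-++; map-tabulate)
open import Data.Nat as ℕ using (ℕ; zero; suc; _∸_; _≤_; _<_; z≤n; s≤s; _<ᵇ_; _≡ᵇ_)
open import Data.Nat.Combinatorics using (_C_; nCk+nC[k+1]≡[n+1]C[k+1]; k>n⇒nCk≡0; nCn≡1)
open import Data.Nat.DivMod using (m/n≡1+[m∸n]/n)
open import Data.Nat.Induction using (<-rec)
import Data.Nat.Properties as ℕₚ
open import Data.Vec using (Vec; []; _∷_; _∷ʳ_; lookup)
open import Function using (_∘_)
open import Relation.Binary.PropositionalEquality hiding ([_])
open import Relation.Nullary.Decidable using (T?)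

≡ᵇ-refl : ∀ k → (k ≡ᵇ k) ≡ true
≡ᵇ-refl zero    = refl
≡ᵇ-refl (suc k) = ≡ᵇ-refl k

<⇒<ᵇ≡true : ∀ {m n} → m < n → (m <ᵇ n) ≡ true
<⇒<ᵇ≡true {zero}  (s≤s _)   = refl
<⇒<ᵇ≡true {suc m} (s≤s m<n) = <⇒<ᵇ≡true m<n

≤⇒<ᵇ≡false : ∀ {m n} → n ≤ m → (m <ᵇ n) ≡ false
≤⇒<ᵇ≡false z≤n       = refl
≤⇒<ᵇ≡false (s≤s n≤m) = ≤⇒<ᵇ≡false n≤m

<ᵇ≡false⇒≥ : ∀ m n → (m <ᵇ n) ≡ false → n ≤ m
<ᵇ≡false⇒≥ m       zero    _  = z≤n
<ᵇ≡false⇒≥ zero    (suc n) ()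
<ᵇ≡false⇒≥ (suc m) (suc n) eq = s≤s (<ᵇ≡false⇒≥ m n eq)

<ᵇ≡true⇒< : ∀ m n → (m <ᵇ n) ≡ true → m < n
<ᵇ≡true⇒< zero    (suc n) _  = s≤s z≤n
<ᵇ≡true⇒< (suc m) (suc n) eq = s≤s (<ᵇ≡true⇒< m n eq)

not-<ᵇ-suc : ∀ a b → not (b <ᵇ suc a) ≡ (a <ᵇ b)
not-<ᵇ-suc a       zero    = refl
not-<ᵇ-suc zero    (suc b) = refl
not-<ᵇ-suc (suc a) (suc b) = not-<ᵇ-suc a b

punchIn : ℕ → ℕ → ℕ
punchIn zero    y       = suc y
punchIn (suc k) zero    = zero
punchIn (suc k) (suc y) = suc (punchIn k y)

punchIn-≢ : ∀ k y → (k ≡ᵇ punchIn k y) ≡ false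
punchIn-≢ zero    y       = refl
punchIn-≢ (suc k) zero    = refl
punchIn-≢ (suc k) (suc y) = punchIn-≢ k y

punchIn-≡ᵇ : ∀ k x y → (punchIn k x ≡ᵇ punchIn k y) ≡ (x ≡ᵇ y)
punchIn-≡ᵇ zero    x       y       = refl
punchIn-≡ᵇ (suc k) zero    zero    = refl
punchIn-≡ᵇ (suc k) zero    (suc y) = refl
punchIn-≡ᵇ (suc k) (suc x) zero    = refl
punchIn-≡ᵇ (suc k) (suc x) (suc y) = punchIn-≡ᵇ k x y

punchIn-<ᵇ : ∀ k x y → (punchIn k x <ᵇ punchIn k y) ≡ (x <ᵇ y)
punchIn-<ᵇ zero    x       y       = refl
punchIn-<ᵇ (suc k) zero    zero    = refl
punchIn-<ᵇ (suc k) zero    (suc y) = refl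
punchIn-<ᵇ (suc k) (suc x) zero    = refl
punchIn-<ᵇ (suc k) (suc x) (suc y) = punchIn-<ᵇ k x y

punchIn-<ᵇ-self : ∀ k y → (punchIn k y <ᵇ k) ≡ (y <ᵇ k)
punchIn-<ᵇ-self zero    y       = refl
punchIn-<ᵇ-self (suc k) zero    = refl
punchIn-<ᵇ-self (suc k) (suc y) = punchIn-<ᵇ-self k y

self-<ᵇ-punchIn : ∀ k y → (k <ᵇ punchIn k y) ≡ not (y <ᵇ k)
self-<ᵇ-punchIn zero    y       = refl
self-<ᵇ-punchIn (suc k) zero    = refl
self-<ᵇ-punchIn (suc k) (suc y) = self-<ᵇ-punchIn k y

punchIn-≥ : ∀ {k y} → k ≤ y → punchIn k y ≡ suc y
punchIn-≥ {zero}  _         = refl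
punchIn-≥ {suc k} (s≤s k≤y) = cong suc (punchIn-≥ k≤y)

punchIn-<ᵇ-≤ : ∀ {a b} z → a ≤ b → (punchIn b z <ᵇ a) ≡ (z <ᵇ a)
punchIn-<ᵇ-≤ {zero}          _       _         = refl
punchIn-<ᵇ-≤ {suc a} {suc b} zero    _         = refl
punchIn-<ᵇ-≤ {suc a} {suc b} (suc z) (s≤s a≤b) = punchIn-<ᵇ-≤ z a≤b

[_] : Bool → ℤ
[ true  ] = + 1
[ false ] = + 0

[∧] : ∀ x y → [ x ∧ y ] ≡ [ x ] * [ y ]
[∧] true  y = sym (*-identityˡ [ y ])
[∧] false y = refl

[]*-complement : ∀ b x → [ b ] * x ≡ x - [ not b ] * x
[]*-complement true  x = trans (*-identityˡ x) (sym (trans (cong (_-_ x) (*-zeroˡ x)) (+-identityʳ x)))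
[]*-complement false x = trans (*-zeroˡ x) (sym (trans (cong (_-_ x) (*-identityˡ x)) (+-inverseʳ x)))

[<ᵇ-suc] : ∀ h k → [ h <ᵇ suc k ] ≡ [ h <ᵇ k ] + [ k ≡ᵇ h ]
[<ᵇ-suc] zero    zero    = refl
[<ᵇ-suc] zero    (suc k) = refl
[<ᵇ-suc] (suc h) zero    = refl
[<ᵇ-suc] (suc h) (suc k) = [<ᵇ-suc] h k

∑ : ℕ → (ℕ → ℤ) → ℤ
∑ zero    f = + 0
∑ (suc n) f = f 0 + ∑ n (λ i → f (suc i))

∑₁ : ℕ → (ℕ → ℤ) → ℤ
∑₁ n f = ∑ n (λ i → f (suc i))

∑-cong : ∀ n {f g : ℕ → ℤ} → (∀ i → i < n → f i ≡ g i) → ∑ n f ≡ ∑ n g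
∑-cong zero    eq = refl
∑-cong (suc n) eq = cong₂ _+_ (eq 0 (s≤s z≤n)) (∑-cong n (λ i i<n → eq (suc i) (s≤s i<n)))

∑-cong′ : ∀ n {f g : ℕ → ℤ} → (∀ i → f i ≡ g i) → ∑ n f ≡ ∑ n g
∑-cong′ n eq = ∑-cong n (λ i _ → eq i)

∑₁-cong : ∀ n {f g : ℕ → ℤ} → (∀ a → 1 ≤ a → a ≤ n → f a ≡ g a) → ∑₁ n f ≡ ∑₁ n g
∑₁-cong n eq = ∑-cong n (λ i i<n → eq (suc i) (s≤s z≤n) i<n)

∑-zero : ∀ n {f : ℕ → ℤ} → (∀ i → i < n → f i ≡ + 0) → ∑ n f ≡ + 0
∑-zero zero    eq = refl
∑-zero (suc n) eq = cong₂ _+_ (eq 0 (s≤s z≤n)) (∑-zero n (λ i i<n → eq (suc i) (s≤s i<n)))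

∑-+ : ∀ n (f g : ℕ → ℤ) → ∑ n (λ i → f i + g i) ≡ ∑ n f + ∑ n g
∑-+ zero    f g = refl
∑-+ (suc n) f g = trans (cong (_+_ (f 0 + g 0)) (∑-+ n _ _)) (interchange (f 0) (g 0) _ _)

∑-neg : ∀ n (f : ℕ → ℤ) → - ∑ n f ≡ ∑ n (λ i → - f i)
∑-neg zero    f = refl
∑-neg (suc n) f = trans (neg-distrib-+ (f 0) _) (cong (_+_ (- f 0)) (∑-neg n _))

∑-- : ∀ n (f g : ℕ → ℤ) → ∑ n (λ i → f i - g i) ≡ ∑ n f - ∑ n g
∑-- n f g = trans (∑-+ n f (λ i → - g i)) (cong (_+_ (∑ n f)) (sym (∑-neg n g)))

*-∑ : ∀ n (c : ℤ) (f : ℕ → ℤ) → c * ∑ n f ≡ ∑ n (λ i → c * f i)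
*-∑ zero    c f = *-zeroʳ c
*-∑ (suc n) c f = trans (*-distribˡ-+ c (f 0) _) (cong (_+_ (c * f 0)) (*-∑ n c _))

∑-* : ∀ n (f : ℕ → ℤ) (c : ℤ) → ∑ n f * c ≡ ∑ n (λ i → f i * c)
∑-* n f c = trans (*-comm (∑ n f) c) (trans (*-∑ n c f) (∑-cong′ n (λ i → *-comm c (f i))))

∑-combination : ∀ n (a b : ℤ) (v w x : ℕ → ℤ) →
  ∑ n (λ i → (a * v i - b * w i) * x i) ≡ a * ∑ n (λ i → v i * x i) - b * ∑ n (λ i → w i * x i)
∑-combination n a b v w x = begin
  ∑ n (λ i → (a * v i - b * w i) * x i)                     ≡⟨ ∑-cong′ n (λ i → distrib a b (v i) (w i) (x i)) ⟩
  ∑ n (λ i → a * (v i * x i) - b * (w i * x i))             ≡⟨ ∑-- n (λ i → a * (v i * x i)) (λ i → b * (w i * x i)) ⟩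
  ∑ n (λ i → a * (v i * x i)) - ∑ n (λ i → b * (w i * x i))
    ≡⟨ cong₂ _-_ (*-∑ n a (λ i → v i * x i)) (*-∑ n b (λ i → w i * x i)) ⟨
  a * ∑ n (λ i → v i * x i) - b * ∑ n (λ i → w i * x i)     ∎
  where
  open ≡-Reasoning
  distrib : ∀ a b v w x → (a * v - b * w) * x ≡ a * (v * x) - b * (w * x)
  distrib = solve-∀

∑-const : ∀ n (c : ℤ) → ∑ n (λ _ → c) ≡ + n * c
∑-const zero    c = sym (*-zeroˡ c)
∑-const (suc n) c = trans (cong (_+_ c) (∑-const n c)) (sym (begin
  + suc n * c          ≡⟨ cong (_* c) (pos-+ 1 n) ⟩
  (+ 1 + + n) * c      ≡⟨ *-distribʳ-+ c (+ 1) (+ n) ⟩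
  + 1 * c + + n * c    ≡⟨ cong (_+ + n * c) (*-identityˡ c) ⟩
  c + + n * c          ∎))
  where open ≡-Reasoning

∑-snoc : ∀ n (f : ℕ → ℤ) → ∑ (suc n) f ≡ ∑ n f + f n
∑-snoc zero    f = +-comm (f 0) (+ 0)
∑-snoc (suc n) f = trans (cong (_+_ (f 0)) (∑-snoc n (λ i → f (suc i)))) (sym (+-assoc (f 0) _ _))

∑-comm : ∀ n m (f : ℕ → ℕ → ℤ) → ∑ n (λ i → ∑ m (f i)) ≡ ∑ m (λ j → ∑ n (λ i → f i j))
∑-comm zero    m f = sym (∑-zero m (λ _ _ → refl))
∑-comm (suc n) m f = trans (cong (_+_ (∑ m (f 0))) (∑-comm n m (λ i → f (suc i))))
                           (sym (∑-+ m (f 0) (λ j → ∑ n (λ i → f (suc i) j))))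

∑-punchIn : ∀ n p → p ≤ n → (f : ℕ → ℤ) → ∑ (suc n) f ≡ f p + ∑ n (λ j → f (punchIn p j))
∑-punchIn n       zero    _         f = refl
∑-punchIn (suc n) (suc p) (s≤s p≤n) f = begin
  f 0 + ∑ (suc n) (λ i → f (suc i))                 ≡⟨ cong (_+_ (f 0)) (∑-punchIn n p p≤n (λ i → f (suc i))) ⟩
  f 0 + (f (suc p) + ∑ n (λ j → f (suc (punchIn p j)))) ≡⟨ x∙yz≈y∙xz (f 0) (f (suc p)) _ ⟩
  f (suc p) + (f 0 + ∑ n (λ j → f (suc (punchIn p j)))) ∎
  where open ≡-Reasoning

∑₁-punchIn : ∀ n k → 1 ≤ k → k ≤ suc n → (f : ℕ → ℤ) → ∑₁ (suc n) f ≡ f k + ∑₁ n (λ j → f (punchIn k j))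
∑₁-punchIn n (suc p) _ (s≤s p≤n) f = ∑-punchIn n p p≤n (λ i → f (suc i))

∑₁-delta : ∀ n k → 1 ≤ k → k ≤ n → (f : ℕ → ℤ) → ∑₁ n (λ a → [ k ≡ᵇ a ] * f a) ≡ f k
∑₁-delta zero    (suc k) _   ()  f
∑₁-delta (suc n) k 1≤k k≤n f = begin
  ∑₁ (suc n) (λ a → [ k ≡ᵇ a ] * f a)
    ≡⟨ ∑₁-punchIn n k 1≤k k≤n (λ a → [ k ≡ᵇ a ] * f a) ⟩
  [ k ≡ᵇ k ] * f k + ∑₁ n (λ j → [ k ≡ᵇ punchIn k j ] * f (punchIn k j))
    ≡⟨ cong₂ _+_ (cong (λ b → [ b ] * f k) (≡ᵇ-refl k))
                 (∑-zero n (λ i _ → cong (λ b → [ b ] * f (punchIn k (suc i))) (punchIn-≢ k (suc i)))) ⟩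
  + 1 * f k + + 0                                             ≡⟨ trans (+-identityʳ _) (*-identityˡ (f k)) ⟩
  f k                                                         ∎
  where open ≡-Reasoning

∑₁-reverse : ∀ n (f : ℕ → ℤ) → ∑₁ n f ≡ ∑₁ n (λ a → f (suc n ∸ a))
∑₁-reverse zero    f = refl
∑₁-reverse (suc n) f = begin
  f 1 + ∑₁ n (λ a → f (suc a))                     ≡⟨ cong (_+_ (f 1)) (∑₁-reverse n (λ a → f (suc a))) ⟩
  f 1 + ∑₁ n (λ a → f (suc (suc n ∸ a)))           ≡⟨ +-comm (f 1) _ ⟩
  ∑₁ n (λ a → f (suc (suc n ∸ a))) + f 1
    ≡⟨ cong₂ _+_ (∑-cong n (λ i i<n → cong f (ℕₚ.+-∸-assoc 1 (ℕₚ.<⇒≤ i<n))))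
                 (cong f (ℕₚ.m+n∸n≡m 1 n)) ⟨
  ∑ n (λ i → f (suc n ∸ i)) + f (suc n ∸ n)        ≡⟨ ∑-snoc n (λ i → f (suc n ∸ i)) ⟨
  ∑₁ (suc n) (λ a → f (suc (suc n) ∸ a))           ∎
  where open ≡-Reasoning

∑₁-restrict-≤ : ∀ M g → g ≤ M → (f : ℕ → ℤ) → ∑₁ M (λ a → [ not (g <ᵇ a) ] * f a) ≡ ∑₁ g f
∑₁-restrict-≤ M       zero    _         f = ∑-zero M (λ i _ → *-zeroˡ (f (suc i)))
∑₁-restrict-≤ (suc M) (suc g) (s≤s g≤M) f =
  cong₂ _+_ (*-identityˡ (f 1)) (∑₁-restrict-≤ M g g≤M (λ a → f (suc a)))

∑₁-restrict-> : ∀ M g → g ≤ M → (f : ℕ → ℤ) → ∑₁ M (λ a → [ g <ᵇ a ] * f a) ≡ ∑₁ M f - ∑₁ g f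
∑₁-restrict-> M g g≤M f = begin
  ∑₁ M (λ a → [ g <ᵇ a ] * f a)                        ≡⟨ ∑-cong′ M (λ i → []*-complement (g <ᵇ suc i) (f (suc i))) ⟩
  ∑₁ M (λ a → f a - [ not (g <ᵇ a) ] * f a)            ≡⟨ ∑-- M (λ i → f (suc i)) _ ⟩
  ∑₁ M f - ∑₁ M (λ a → [ not (g <ᵇ a) ] * f a)         ≡⟨ cong (_-_ (∑₁ M f)) (∑₁-restrict-≤ M g g≤M f) ⟩
  ∑₁ M f - ∑₁ g f                                      ∎
  where open ≡-Reasoning

#filter : (List ℕ → Bool) → List (List ℕ) → ℤ
#filter P ws = + length (filterᵇ P ws)

#filter-∷ : ∀ P w ws → #filter P (w ∷ ws) ≡ [ P w ] + #filter P ws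
#filter-∷ P w ws with P w
... | true  = refl
... | false = refl

#filter-++ : ∀ P us vs → #filter P (us ++ vs) ≡ #filter P us + #filter P vs
#filter-++ P us vs = cong +_ (trans (cong length (filter-++ (T? ∘ P) us vs)) (length-++ (filterᵇ P us)))

#filter-applyUpTo : ∀ P (g : ℕ → List ℕ) (f : ℕ → ℕ) n →
  #filter P (map g (applyUpTo f n)) ≡ ∑ n (λ i → [ P (g (f i)) ])
#filter-applyUpTo P g f zero    = refl
#filter-applyUpTo P g f (suc n) =
  trans (#filter-∷ P (g (f 0)) _) (cong (_+_ [ P (g (f 0)) ]) (#filter-applyUpTo P g (λ i → f (suc i)) n))

count : ℕ → ℕ → (List ℕ → Bool) → ℤ
count n zero    P = [ P [] ]
count n (suc m) P = ∑₁ n (λ a → count n m (λ w → P (a ∷ w)))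

#filter-extend : ∀ P n ws →
  #filter P (concatMap (λ w → map (_∷ w) (applyUpTo suc n)) ws) ≡ ∑₁ n (λ a → #filter (λ w → P (a ∷ w)) ws)
#filter-extend P n []       = sym (∑-zero n (λ _ _ → refl))
#filter-extend P n (w ∷ ws) = begin
  #filter P (map (_∷ w) (applyUpTo suc n) ++ concatMap _ ws)
    ≡⟨ #filter-++ P (map (_∷ w) (applyUpTo suc n)) _ ⟩
  #filter P (map (_∷ w) (applyUpTo suc n)) + #filter P (concatMap _ ws)
    ≡⟨ cong₂ _+_ (#filter-applyUpTo P (_∷ w) suc n) (#filter-extend P n ws) ⟩
  ∑₁ n (λ a → [ P (a ∷ w) ]) + ∑₁ n (λ a → #filter (λ v → P (a ∷ v)) ws)
    ≡⟨ ∑-+ n _ _ ⟨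
  ∑₁ n (λ a → [ P (a ∷ w) ] + #filter (λ v → P (a ∷ v)) ws)
    ≡⟨ ∑-cong′ n (λ i → #filter-∷ (λ v → P (suc i ∷ v)) w ws) ⟨
  ∑₁ n (λ a → #filter (λ v → P (a ∷ v)) (w ∷ ws)) ∎
  where open ≡-Reasoning

#filter-words : ∀ n m P → #filter P (words n m) ≡ count n m P
#filter-words n zero    P = trans (#filter-∷ P [] []) (+-identityʳ [ P [] ])
#filter-words n (suc m) P =
  trans (#filter-extend P n (words n m)) (∑-cong′ n (λ i → #filter-words n m (λ w → P (suc i ∷ w))))

count-cong : ∀ n m {P Q : List ℕ → Bool} →
  (∀ w → length w ≡ m → allᵇ (inRange n) w ≡ true → P w ≡ Q w) → count n m P ≡ count n m Q
count-cong n zero    eq = cong [_] (eq [] refl refl)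
count-cong n (suc m) eq = ∑-cong n (λ i i<n → count-cong n m (λ w len range →
  eq (suc i ∷ w) (cong suc len) (cong₂ _∧_ (<⇒<ᵇ≡true (s≤s i<n)) range)))

count-cong′ : ∀ n m {P Q : List ℕ → Bool} → (∀ w → P w ≡ Q w) → count n m P ≡ count n m Q
count-cong′ n m eq = count-cong n m (λ w _ _ → eq w)

count-false : ∀ n m → count n m (λ _ → false) ≡ + 0
count-false n zero    = refl
count-false n (suc m) = ∑-zero n (λ _ _ → count-false n m)

count-∧ : ∀ n m b (P : List ℕ → Bool) → count n m (λ w → b ∧ P w) ≡ [ b ] * count n m P
count-∧ n m true  P = sym (*-identityˡ _)
count-∧ n m false P = count-false n m

avoids : ℕ → List ℕ → Bool
avoids k w = allᵇ (λ b → not (k ≡ᵇ b)) w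

count-avoiding : ∀ n m k → 1 ≤ k → k ≤ suc n → (P : List ℕ → Bool) →
  count (suc n) m (λ w → avoids k w ∧ P w) ≡ count n m (λ v → P (map (punchIn k) v))
count-avoiding n zero    k _   _   P = refl
count-avoiding n (suc m) k 1≤k k≤n P = begin
  ∑₁ (suc n) (λ a → count (suc n) m (λ w → (not (k ≡ᵇ a) ∧ avoids k w) ∧ P (a ∷ w)))
    ≡⟨ ∑₁-punchIn n k 1≤k k≤n (λ a → count (suc n) m (λ w → (not (k ≡ᵇ a) ∧ avoids k w) ∧ P (a ∷ w))) ⟩
  count (suc n) m (λ w → (not (k ≡ᵇ k) ∧ avoids k w) ∧ P (k ∷ w))
    + ∑₁ n (λ a → count (suc n) m (λ w → (not (k ≡ᵇ punchIn k a) ∧ avoids k w) ∧ P (punchIn k a ∷ w)))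
    ≡⟨ cong₂ _+_ (trans (count-cong′ (suc n) m (λ w → cong (λ b → (not b ∧ avoids k w) ∧ P (k ∷ w)) (≡ᵇ-refl k)))
                        (count-false (suc n) m))
                 (∑-cong′ n (λ i → count-cong′ (suc n) m (λ w →
                   cong (λ b → (not b ∧ avoids k w) ∧ P (punchIn k (suc i) ∷ w)) (punchIn-≢ k (suc i))))) ⟩
  + 0 + ∑₁ n (λ a → count (suc n) m (λ w → avoids k w ∧ P (punchIn k a ∷ w)))
    ≡⟨ +-identityˡ _ ⟩
  ∑₁ n (λ a → count (suc n) m (λ w → avoids k w ∧ P (punchIn k a ∷ w)))
    ≡⟨ ∑-cong′ n (λ i → count-avoiding n m k 1≤k k≤n (λ w → P (punchIn k (suc i) ∷ w))) ⟩
  ∑₁ n (λ a → count n m (λ v → P (punchIn k a ∷ map (punchIn k) v))) ∎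
  where open ≡-Reasoning

avoids-map : ∀ k x ys → avoids (punchIn k x) (map (punchIn k) ys) ≡ avoids x ys
avoids-map k x []       = refl
avoids-map k x (y ∷ ys) = cong₂ _∧_ (cong not (punchIn-≡ᵇ k x y)) (avoids-map k x ys)

distinct-map : ∀ k xs → distinct (map (punchIn k) xs) ≡ distinct xs
distinct-map k []       = refl
distinct-map k (x ∷ xs) = cong₂ _∧_ (avoids-map k x xs) (distinct-map k xs)

mutual
  altUp-map : ∀ k xs → altUp (map (punchIn k) xs) ≡ altUp xs
  altUp-map k []          = refl
  altUp-map k (x ∷ [])    = refl
  altUp-map k (x ∷ y ∷ r) = cong₂ _∧_ (punchIn-<ᵇ k x y) (altDown-map k (y ∷ r))

  altDown-map : ∀ k xs → altDown (map (punchIn k) xs) ≡ altDown xs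
  altDown-map k []          = refl
  altDown-map k (x ∷ [])    = refl
  altDown-map k (x ∷ y ∷ r) = cong₂ _∧_ (punchIn-<ᵇ k y x) (altUp-map k (y ∷ r))

permCount : ℕ → (List ℕ → Bool) → ℤ
permCount n P = count n n (λ σ → distinct σ ∧ P σ)

permCount-suc : ∀ n (P : List ℕ → Bool) →
  permCount (suc n) P ≡ ∑₁ (suc n) (λ a → permCount n (λ σ → P (a ∷ map (punchIn a) σ)))
permCount-suc n P = ∑₁-cong (suc n) (λ a 1≤a a≤n → begin
  count (suc n) n (λ σ → (avoids a σ ∧ distinct σ) ∧ P (a ∷ σ))
    ≡⟨ count-cong′ (suc n) n (λ σ → ∧-assoc (avoids a σ) (distinct σ) (P (a ∷ σ))) ⟩
  count (suc n) n (λ σ → avoids a σ ∧ (distinct σ ∧ P (a ∷ σ)))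
    ≡⟨ count-avoiding n n a 1≤a a≤n (λ σ → distinct σ ∧ P (a ∷ σ)) ⟩
  count n n (λ σ → distinct (map (punchIn a) σ) ∧ P (a ∷ map (punchIn a) σ))
    ≡⟨ count-cong′ n n (λ σ → cong (_∧ P (a ∷ map (punchIn a) σ)) (distinct-map a σ)) ⟩
  permCount n (λ σ → P (a ∷ map (punchIn a) σ)) ∎)
  where open ≡-Reasoning

permCount-∧ : ∀ n b (P : List ℕ → Bool) → permCount n (λ σ → b ∧ P σ) ≡ [ b ] * permCount n P
permCount-∧ n b P = trans (count-cong′ n n (λ σ → ∧-swapˡ (distinct σ) b (P σ))) (count-∧ n n b _)
  where
  ∧-swapˡ : ∀ x b y → x ∧ (b ∧ y) ≡ b ∧ (x ∧ y)
  ∧-swapˡ x true  y = refl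
  ∧-swapˡ x false y = ∧-zeroʳ x

startsWith : ℕ → List ℕ → Bool
startsWith c []      = false
startsWith c (x ∷ _) = c ≡ᵇ x

permCount-startsWith : ∀ n c → 1 ≤ c → c ≤ suc n → (P : List ℕ → Bool) →
  permCount (suc n) (λ σ → startsWith c σ ∧ P σ) ≡ permCount n (λ σ → P (c ∷ map (punchIn c) σ))
permCount-startsWith n c 1≤c c≤n P = begin
  permCount (suc n) (λ σ → startsWith c σ ∧ P σ)
    ≡⟨ permCount-suc n (λ σ → startsWith c σ ∧ P σ) ⟩
  ∑₁ (suc n) (λ a → permCount n (λ σ → (c ≡ᵇ a) ∧ P (a ∷ map (punchIn a) σ)))
    ≡⟨ ∑-cong′ (suc n) (λ i → permCount-∧ n (c ≡ᵇ suc i) (λ σ → P (suc i ∷ map (punchIn (suc i)) σ))) ⟩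
  ∑₁ (suc n) (λ a → [ c ≡ᵇ a ] * permCount n (λ σ → P (a ∷ map (punchIn a) σ)))
    ≡⟨ ∑₁-delta (suc n) c 1≤c c≤n (λ a → permCount n (λ σ → P (a ∷ map (punchIn a) σ))) ⟩
  permCount n (λ σ → P (c ∷ map (punchIn c) σ)) ∎
  where open ≡-Reasoning

numA3412≡permCount : ∀ n → + numA3412 n ≡ permCount n (λ σ → altUp σ ∧ pattern3412 σ)
numA3412≡permCount n = trans (#filter-words n n _) (count-cong n n simplify)
  where
  simplify : ∀ σ → length σ ≡ n → allᵇ (inRange n) σ ≡ true →
    isPerm n σ ∧ isAlternating σ ∧ pattern3412 σ ≡ distinct σ ∧ altUp σ ∧ pattern3412 σ
  simplify σ refl range rewrite ≡ᵇ-refl (length σ) | range = refl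

up down : ℕ → ℕ → ℤ
up   n c = permCount n (λ σ → startsWith c σ ∧ altUp σ)
down n c = permCount n (λ σ → startsWith c σ ∧ altDown σ)

permCount-startsWith-suc : ∀ n c → 1 ≤ c → c ≤ suc (suc n) → (P : List ℕ → Bool) →
  permCount (suc (suc n)) (λ σ → startsWith c σ ∧ P σ)
  ≡ ∑₁ (suc n) (λ h → permCount n (λ σ → P (c ∷ map (punchIn c) (h ∷ map (punchIn h) σ))))
permCount-startsWith-suc n c 1≤c c≤n P =
  trans (permCount-startsWith (suc n) c 1≤c c≤n P) (permCount-suc n (λ τ → P (c ∷ map (punchIn c) τ)))

up-suc : ∀ n c → 1 ≤ c → c ≤ suc (suc n) →
  up (suc (suc n)) c ≡ ∑₁ (suc n) (λ h → [ not (h <ᵇ c) ] * down (suc n) h)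
up-suc n c 1≤c c≤n = trans (permCount-startsWith-suc n c 1≤c c≤n altUp) (∑₁-cong (suc n) (λ h 1≤h h≤n →
  trans (count-cong′ n n (λ σ → cong (distinct σ ∧_)
          (cong₂ _∧_ (self-<ᵇ-punchIn c h) (altDown-map c (h ∷ map (punchIn h) σ)))))
  (trans (permCount-∧ n (not (h <ᵇ c)) (λ σ → altDown (h ∷ map (punchIn h) σ)))
         (cong ([ not (h <ᵇ c) ] *_) (sym (permCount-startsWith n h 1≤h h≤n altDown))))))

down-suc : ∀ n c → 1 ≤ c → c ≤ suc (suc n) →
  down (suc (suc n)) c ≡ ∑₁ (suc n) (λ h → [ h <ᵇ c ] * up (suc n) h)
down-suc n c 1≤c c≤n = trans (permCount-startsWith-suc n c 1≤c c≤n altDown) (∑₁-cong (suc n) (λ h 1≤h h≤n →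
  trans (count-cong′ n n (λ σ → cong (distinct σ ∧_)
          (cong₂ _∧_ (punchIn-<ᵇ-self c h) (altUp-map c (h ∷ map (punchIn h) σ)))))
  (trans (permCount-∧ n (h <ᵇ c) (λ σ → altUp (h ∷ map (punchIn h) σ)))
         (cong ([ h <ᵇ c ] *_) (sym (permCount-startsWith n h 1≤h h≤n altUp))))))

complement-<ᵇ : ∀ N h k → h ≤ N → (N ∸ h <ᵇ suc N ∸ k) ≡ not (h <ᵇ k)
complement-<ᵇ N       h       zero    _         = <⇒<ᵇ≡true (s≤s (ℕₚ.m∸n≤m N h))
complement-<ᵇ N       zero    (suc k) _         = ≤⇒<ᵇ≡false (ℕₚ.m∸n≤m N k)
complement-<ᵇ (suc N) (suc h) (suc k) (s≤s h≤N) = complement-<ᵇ N h k h≤N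

up≡down-complement : ∀ n k → 1 ≤ k → k ≤ suc n → up (suc n) k ≡ down (suc n) (suc (suc n) ∸ k)
up≡down-complement zero    (suc zero)    _   _        = refl
up≡down-complement zero    (suc (suc k)) _   (s≤s ())
up≡down-complement (suc n) k             1≤k k≤n      = begin
  up (suc (suc n)) k
    ≡⟨ up-suc n k 1≤k k≤n ⟩
  ∑₁ (suc n) (λ h → [ not (h <ᵇ k) ] * down (suc n) h)
    ≡⟨ ∑₁-cong (suc n) (λ h _ h≤n → cong₂ (λ b x → [ b ] * down (suc n) x)
         (complement-<ᵇ (suc (suc n)) h k (ℕₚ.m≤n⇒m≤1+n h≤n)) (ℕₚ.m∸[m∸n]≡n (ℕₚ.m≤n⇒m≤1+n h≤n))) ⟨
  ∑₁ (suc n) (λ h → [ suc (suc n) ∸ h <ᵇ k′ ] * down (suc n) (suc (suc n) ∸ (suc (suc n) ∸ h)))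
    ≡⟨ ∑₁-reverse (suc n) (λ h → [ h <ᵇ k′ ] * down (suc n) (suc (suc n) ∸ h)) ⟨
  ∑₁ (suc n) (λ h → [ h <ᵇ k′ ] * down (suc n) (suc (suc n) ∸ h))
    ≡⟨ ∑₁-cong (suc n) (λ h 1≤h h≤n → cong ([ h <ᵇ k′ ] *_) (up≡down-complement n h 1≤h h≤n)) ⟨
  ∑₁ (suc n) (λ h → [ h <ᵇ k′ ] * up (suc n) h)
    ≡⟨ down-suc n k′ 1≤k′ k′≤n ⟨
  down (suc (suc n)) k′ ∎
  where
  open ≡-Reasoning
  k′ = suc (suc (suc n)) ∸ k
  1≤k′ : 1 ≤ k′
  1≤k′ = subst (1 ≤_) (sym (ℕₚ.+-∸-assoc 1 k≤n)) (s≤s z≤n)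
  k′≤n : k′ ≤ suc (suc n)
  k′≤n = ℕₚ.∸-monoʳ-≤ (suc (suc (suc n))) 1≤k

down-suc-suc : ∀ N n → n ≤ N →
  down (suc (suc N)) (suc (suc n)) ≡ down (suc (suc N)) (suc n) + up (suc N) (suc n)
down-suc-suc N n n≤N = begin
  down (suc (suc N)) (suc (suc n))
    ≡⟨ down-suc N (suc (suc n)) (s≤s z≤n) (s≤s (s≤s n≤N)) ⟩
  ∑₁ (suc N) (λ h → [ h <ᵇ suc (suc n) ] * up (suc N) h)
    ≡⟨ ∑-cong′ (suc N) (λ i → trans (cong (_* up (suc N) (suc i)) ([<ᵇ-suc] (suc i) (suc n)))
                                     (*-distribʳ-+ (up (suc N) (suc i)) [ suc i <ᵇ suc n ] _)) ⟩
  ∑₁ (suc N) (λ h → [ h <ᵇ suc n ] * up (suc N) h + [ suc n ≡ᵇ h ] * up (suc N) h)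
    ≡⟨ ∑-+ (suc N) (λ i → [ suc i <ᵇ suc n ] * up (suc N) (suc i))
                   (λ i → [ suc n ≡ᵇ suc i ] * up (suc N) (suc i)) ⟩
  ∑₁ (suc N) (λ h → [ h <ᵇ suc n ] * up (suc N) h) + ∑₁ (suc N) (λ h → [ suc n ≡ᵇ h ] * up (suc N) h)
    ≡⟨ cong₂ _+_ (down-suc N (suc n) (s≤s z≤n) (s≤s (ℕₚ.m≤n⇒m≤1+n n≤N)))
                 (sym (∑₁-delta (suc N) (suc n) (s≤s z≤n) (s≤s n≤N) (up (suc N)))) ⟨
  down (suc (suc N)) (suc n) + up (suc N) (suc n) ∎
  where open ≡-Reasoning

entringer : ℕ → ℕ → ℤ
entringer m n = down (suc (m ℕ.+ n)) (suc n)

entringer-zero : ∀ m → entringer m 0 ≡ δ₀ m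
entringer-zero zero    = refl
entringer-zero (suc m) =
  trans (down-suc (m ℕ.+ 0) 1 (s≤s z≤n) (s≤s z≤n))
        (∑-zero (suc (m ℕ.+ 0)) (λ i _ → *-zeroˡ (up (suc (m ℕ.+ 0)) (suc i))))

entringer-suc : ∀ m n → entringer m (suc n) ≡ entringer (suc m) n + entringer n m
entringer-suc m n = begin
  down (suc (m ℕ.+ suc n)) (suc (suc n))
    ≡⟨ cong (λ x → down (suc x) (suc (suc n))) (ℕₚ.+-suc m n) ⟩
  down (suc (suc (m ℕ.+ n))) (suc (suc n))
    ≡⟨ down-suc-suc (m ℕ.+ n) n (ℕₚ.m≤n+m n m) ⟩
  down (suc (suc (m ℕ.+ n))) (suc n) + up (suc (m ℕ.+ n)) (suc n)
    ≡⟨ cong (_+_ (entringer (suc m) n)) (up≡down-complement (m ℕ.+ n) (suc n) (s≤s z≤n) (s≤s (ℕₚ.m≤n+m n m))) ⟩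
  entringer (suc m) n + down (suc (m ℕ.+ n)) (suc (m ℕ.+ n) ∸ n)
    ≡⟨ cong (_+_ (entringer (suc m) n)) (cong₂ (λ x y → down (suc x) y)
         (ℕₚ.+-comm m n) (trans (ℕₚ.+-∸-assoc 1 (ℕₚ.m≤n+m n m)) (cong suc (ℕₚ.m+n∸n≡m m n)))) ⟩
  entringer (suc m) n + entringer n m ∎
  where open ≡-Reasoning

sign-suc : ∀ k → sign (suc k) ≡ - sign k
sign-suc zero          = refl
sign-suc (suc zero)    = refl
sign-suc (suc (suc k)) = sign-suc k

cosC-suc-suc : ∀ m → cosC (suc (suc m)) ≡ - cosC m
cosC-suc-suc m rewrite m/n≡1+[m∸n]/n {suc (suc m)} {2} (s≤s (s≤s z≤n)) with m ℕ.% 2 ≡ᵇ 0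
... | true  = sign-suc (m ℕ./ 2)
... | false = refl

sinC-suc-suc : ∀ m → sinC (suc (suc m)) ≡ - sinC m
sinC-suc-suc m rewrite m/n≡1+[m∸n]/n {suc (suc m)} {2} (s≤s (s≤s z≤n)) with m ℕ.% 2 ≡ᵇ 1
... | true  = sign-suc (m ℕ./ 2)
... | false = refl

mutual
  sinC-suc : ∀ n → sinC (suc n) ≡ cosC n
  sinC-suc zero    = refl
  sinC-suc (suc n) = trans (sinC-suc-suc n) (sym (cosC-suc n))

  cosC-suc : ∀ n → cosC (suc n) ≡ - sinC n
  cosC-suc zero    = refl
  cosC-suc (suc n) = trans (cosC-suc-suc n) (cong -_ (sym (sinC-suc n)))

binomialSum : ℕ → (ℕ → ℕ → ℤ) → ℤ
binomialSum n Φ = ∑ (suc n) (λ j → + (n C j) * Φ j (n ∸ j))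

binomialSum-cong : ∀ n {Φ Ψ : ℕ → ℕ → ℤ} → (∀ j l → Φ j l ≡ Ψ j l) → binomialSum n Φ ≡ binomialSum n Ψ
binomialSum-cong n eq = ∑-cong′ (suc n) (λ j → cong (+ (n C j) *_) (eq j (n ∸ j)))

binomialSum-+ : ∀ n (Φ Ψ : ℕ → ℕ → ℤ) →
  binomialSum n (λ j l → Φ j l + Ψ j l) ≡ binomialSum n Φ + binomialSum n Ψ
binomialSum-+ n Φ Ψ =
  trans (∑-cong′ (suc n) (λ j → *-distribˡ-+ (+ (n C j)) (Φ j (n ∸ j)) (Ψ j (n ∸ j))))
        (∑-+ (suc n) (λ j → + (n C j) * Φ j (n ∸ j)) (λ j → + (n C j) * Ψ j (n ∸ j)))

binomialSum-suc : ∀ n (Φ : ℕ → ℕ → ℤ) →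
  binomialSum (suc n) Φ ≡ binomialSum n (λ j l → Φ (suc j) l) + binomialSum n (λ j l → Φ j (suc l))
binomialSum-suc n Φ = begin
  + 1 * Φ 0 (suc n) + ∑ (suc n) (λ j → + (suc n C suc j) * Φ (suc j) (n ∸ j))
    ≡⟨ cong (_+_ (+ 1 * Φ 0 (suc n))) (trans (∑-cong′ (suc n) pascal) (∑-+ (suc n) A B)) ⟩
  + 1 * Φ 0 (suc n) + (∑ (suc n) A + ∑ (suc n) B)
    ≡⟨ x∙yz≈y∙xz (+ 1 * Φ 0 (suc n)) (∑ (suc n) A) (∑ (suc n) B) ⟩
  ∑ (suc n) A + (+ 1 * Φ 0 (suc n) + ∑ (suc n) B)
    ≡⟨ cong (λ x → ∑ (suc n) A + (+ 1 * Φ 0 (suc n) + x)) dropLast ⟩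
  binomialSum n (λ j l → Φ (suc j) l) + binomialSum n (λ j l → Φ j (suc l)) ∎
  where
  open ≡-Reasoning
  A B : ℕ → ℤ
  A j = + (n C j) * Φ (suc j) (n ∸ j)
  B j = + (n C suc j) * Φ (suc j) (n ∸ j)
  pascal : ∀ j → + (suc n C suc j) * Φ (suc j) (n ∸ j) ≡ A j + B j
  pascal j = trans (cong (λ c → + c * Φ (suc j) (n ∸ j)) (sym (nCk+nC[k+1]≡[n+1]C[k+1] n j)))
                   (*-distribʳ-+ (Φ (suc j) (n ∸ j)) (+ (n C j)) (+ (n C suc j)))
  dropLast : ∑ (suc n) B ≡ ∑ n (λ j → + (n C suc j) * Φ (suc j) (suc (n ∸ suc j)))
  dropLast = begin
    ∑ (suc n) B   ≡⟨ ∑-snoc n B ⟩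
    ∑ n B + B n   ≡⟨ cong (λ c → ∑ n B + + c * Φ (suc n) (n ∸ n)) (k>n⇒nCk≡0 (ℕₚ.n<1+n n)) ⟩
    ∑ n B + + 0 * Φ (suc n) (n ∸ n)   ≡⟨ cong (_+_ (∑ n B)) (*-zeroˡ (Φ (suc n) (n ∸ n))) ⟩
    ∑ n B + + 0   ≡⟨ +-identityʳ (∑ n B) ⟩
    ∑ n B         ≡⟨ ∑-cong n (λ j j<n → cong (λ l → + (n C suc j) * Φ (suc j) l) (ℕₚ.+-∸-assoc 1 j<n)) ⟩
    ∑ n (λ j → + (n C suc j) * Φ (suc j) (suc (n ∸ suc j))) ∎

-- Coefficients, with respect to xᵐ yⁿ / (m! n!), of a product of bivariate exponential generating functions.
_⋆_ : (ℕ → ℕ → ℤ) → (ℕ → ℕ → ℤ) → ℕ → ℕ → ℤ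
(A ⋆ B) m n = binomialSum n (λ j l → binomialSum m (λ i k → A i j * B k l))

⋆-cong : ∀ {A A′ B B′ : ℕ → ℕ → ℤ} m n → (∀ i j → A i j ≡ A′ i j) → (∀ k l → B k l ≡ B′ k l) →
  (A ⋆ B) m n ≡ (A′ ⋆ B′) m n
⋆-cong m n eqA eqB = binomialSum-cong n (λ j l → binomialSum-cong m (λ i k → cong₂ _*_ (eqA i j) (eqB k l)))

⋆-sucʳ : ∀ A B m n →
  (A ⋆ B) m (suc n) ≡ ((λ i j → A i (suc j)) ⋆ B) m n + (A ⋆ (λ k l → B k (suc l))) m n
⋆-sucʳ A B m n = binomialSum-suc n (λ j l → binomialSum m (λ i k → A i j * B k l))

⋆-sucˡ : ∀ A B m n →
  (A ⋆ B) (suc m) n ≡ ((λ i j → A (suc i) j) ⋆ B) m n + (A ⋆ (λ k l → B (suc k) l)) m n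
⋆-sucˡ A B m n =
  trans (binomialSum-cong n (λ j l → binomialSum-suc m (λ i k → A i j * B k l)))
        (binomialSum-+ n (λ j l → binomialSum m (λ i k → A (suc i) j * B k l))
                         (λ j l → binomialSum m (λ i k → A i j * B (suc k) l)))

⋆-distribʳ-+ : ∀ A A′ B m n → ((λ i j → A i j + A′ i j) ⋆ B) m n ≡ (A ⋆ B) m n + (A′ ⋆ B) m n
⋆-distribʳ-+ A A′ B m n =
  trans (binomialSum-cong n (λ j l →
           trans (binomialSum-cong m (λ i k → *-distribʳ-+ (B k l) (A i j) (A′ i j)))
                 (binomialSum-+ m (λ i k → A i j * B k l) (λ i k → A′ i j * B k l))))
        (binomialSum-+ n (λ j l → binomialSum m (λ i k → A i j * B k l))
                         (λ j l → binomialSum m (λ i k → A′ i j * B k l)))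

⋆-transpose : ∀ A B m n → (A ⋆ B) m n ≡ ((λ i j → A j i) ⋆ (λ k l → B l k)) n m
⋆-transpose A B m n = begin
  ∑ (suc n) (λ j → a j * ∑ (suc m) (λ i → b i * X i j))
    ≡⟨ ∑-cong′ (suc n) (λ j → trans (*-∑ (suc m) (a j) (λ i → b i * X i j))
                                     (∑-cong′ (suc m) (λ i → x*yz≡y*xz (a j) (b i) (X i j)))) ⟩
  ∑ (suc n) (λ j → ∑ (suc m) (λ i → b i * (a j * X i j)))
    ≡⟨ ∑-comm (suc n) (suc m) (λ j i → b i * (a j * X i j)) ⟩
  ∑ (suc m) (λ i → ∑ (suc n) (λ j → b i * (a j * X i j)))
    ≡⟨ ∑-cong′ (suc m) (λ i → *-∑ (suc n) (b i) (λ j → a j * X i j)) ⟨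
  ∑ (suc m) (λ i → b i * ∑ (suc n) (λ j → a j * X i j)) ∎
  where
  open ≡-Reasoning
  a b : ℕ → ℤ
  a j = + (n C j)
  b i = + (m C i)
  X : ℕ → ℕ → ℤ
  X i j = A i j * B (m ∸ i) (n ∸ j)

⋆-δ₀ : ∀ A B m → (∀ i → A i 0 ≡ δ₀ i) → (A ⋆ B) m 0 ≡ B m 0
⋆-δ₀ A B m A-δ₀ = begin
  + 1 * (+ 1 * (A 0 0 * B m 0) + higherTerms) + + 0
    ≡⟨ cong₂ (λ x y → + 1 * (+ 1 * (x * B m 0) + y) + + 0) (A-δ₀ 0) (∑-zero m (λ i _ → higher i)) ⟩
  + 1 * (+ 1 * (+ 1 * B m 0) + + 0) + + 0
    ≡⟨ 1[1[1x]+0]+0≡x (B m 0) ⟩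
  B m 0 ∎
  where
  open ≡-Reasoning
  higherTerms = ∑ m (λ i → + (m C suc i) * (A (suc i) 0 * B (m ∸ suc i) 0))
  higher : ∀ i → + (m C suc i) * (A (suc i) 0 * B (m ∸ suc i) 0) ≡ + 0
  higher i = trans (cong (λ x → + (m C suc i) * (x * B (m ∸ suc i) 0)) (A-δ₀ (suc i))) (*-zeroʳ (+ (m C suc i)))
  1[1[1x]+0]+0≡x : ∀ x → + 1 * (+ 1 * (+ 1 * x) + + 0) + + 0 ≡ x
  1[1[1x]+0]+0≡x = solve-∀

Boustrophedon : (ℕ → ℕ → ℤ) → Set
Boustrophedon X = ∀ m n → X m (suc n) ≡ X (suc m) n + X n m

boustrophedon-unique : ∀ {X Y} → Boustrophedon X → Boustrophedon Y → (∀ m → X m 0 ≡ Y m 0) →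
  ∀ m n → X m n ≡ Y m n
boustrophedon-unique {X} {Y} recX recY base m n = go (m ℕ.+ n) m n refl
  where
  go : ∀ N m n → m ℕ.+ n ≡ N → X m n ≡ Y m n
  go N       m zero    _  = base m
  go zero    m (suc n) eq = ⊥-elim (ℕₚ.0≢1+n (trans (sym eq) (ℕₚ.+-suc m n)))
  go (suc N) m (suc n) eq = begin
    X m (suc n)           ≡⟨ recX m n ⟩
    X (suc m) n + X n m   ≡⟨ cong₂ _+_ (go (suc N) (suc m) n (trans (sym (ℕₚ.+-suc m n)) eq))
                                       (go N n m (ℕₚ.suc-injective (trans (cong suc (ℕₚ.+-comm n m))
                                                                          (trans (sym (ℕₚ.+-suc m n)) eq)))) ⟩
    Y (suc m) n + Y n m   ≡⟨ recY m n ⟨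
    Y m (suc n)           ∎
    where open ≡-Reasoning

⋆-boustrophedon : ∀ A (g : ℕ → ℤ) → Boustrophedon A → Boustrophedon (A ⋆ (λ k l → g (k ℕ.+ l)))
⋆-boustrophedon A g recA m n = begin
  (A ⋆ G) m (suc n)
    ≡⟨ ⋆-sucʳ A G m n ⟩
  ((λ i j → A i (suc j)) ⋆ G) m n + (A ⋆ (λ k l → G k (suc l))) m n
    ≡⟨ cong₂ _+_ (⋆-cong {A′ = λ i j → A (suc i) j + A j i} {B = G} m n recA (λ _ _ → refl))
                 (⋆-cong {A = A} {B′ = λ k l → G (suc k) l} m n (λ _ _ → refl) (λ k l → cong g (ℕₚ.+-suc k l))) ⟩
  ((λ i j → A (suc i) j + A j i) ⋆ G) m n + (A ⋆ (λ k l → G (suc k) l)) m n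
    ≡⟨ cong (_+ (A ⋆ (λ k l → G (suc k) l)) m n) (⋆-distribʳ-+ (λ i j → A (suc i) j) (λ i j → A j i) G m n) ⟩
  ((λ i j → A (suc i) j) ⋆ G) m n + ((λ i j → A j i) ⋆ G) m n + (A ⋆ (λ k l → G (suc k) l)) m n
    ≡⟨ xy∙z≈xz∙y (((λ i j → A (suc i) j) ⋆ G) m n) (((λ i j → A j i) ⋆ G) m n)
                 ((A ⋆ (λ k l → G (suc k) l)) m n) ⟩
  ((λ i j → A (suc i) j) ⋆ G) m n + (A ⋆ (λ k l → G (suc k) l)) m n + ((λ i j → A j i) ⋆ G) m n
    ≡⟨ cong₂ _+_ (⋆-sucˡ A G m n)
                 (sym (trans (⋆-transpose (λ i j → A j i) G m n)
                             (⋆-cong {A = A} {B = λ k l → G l k} {B′ = G} n m (λ _ _ → refl)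
                                     (λ k l → cong g (ℕₚ.+-comm l k))))) ⟨
  (A ⋆ G) (suc m) n + (A ⋆ G) n m ∎
  where
  open ≡-Reasoning
  G : ℕ → ℕ → ℤ
  G k l = g (k ℕ.+ l)

-- The coefficients of cos x + sin y.
cosSin : ℕ → ℕ → ℤ
cosSin m n = δ₀ n * cosC m + δ₀ m * sinC n

cosSin-boustrophedon : Boustrophedon cosSin
cosSin-boustrophedon m n rewrite sinC-suc n | cosC-suc m = identity (δ₀ m) (δ₀ n) (cosC m) (sinC m) (cosC n) (sinC n)
  where
  identity : ∀ (δm δn cm sm cn sn : ℤ) → + 0 * cm + δm * cn ≡ δn * (- sm) + + 0 * sn + (δm * cn + δn * sm)
  identity = solve-∀

entringer⋆cos : ∀ m n → (entringer ⋆ (λ k l → cosC (k ℕ.+ l))) m n ≡ cosSin m n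
entringer⋆cos = boustrophedon-unique (⋆-boustrophedon entringer cosC entringer-suc) cosSin-boustrophedon firstColumn
  where
  open ≡-Reasoning
  firstColumn : ∀ m → (entringer ⋆ (λ k l → cosC (k ℕ.+ l))) m 0 ≡ cosSin m 0
  firstColumn m = begin
    (entringer ⋆ (λ k l → cosC (k ℕ.+ l))) m 0 ≡⟨ ⋆-δ₀ entringer (λ k l → cosC (k ℕ.+ l)) m entringer-zero ⟩
    cosC (m ℕ.+ 0)                              ≡⟨ cong cosC (ℕₚ.+-identityʳ m) ⟩
    cosC m                                      ≡⟨ *-identityˡ (cosC m) ⟨
    + 1 * cosC m                                ≡⟨ +-identityʳ (+ 1 * cosC m) ⟨
    + 1 * cosC m + + 0                          ≡⟨ cong (_+_ (+ 1 * cosC m)) (*-zeroʳ (δ₀ m)) ⟨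
    cosSin m 0                                  ∎

EulerRecurrence : (ℕ → ℤ) → Set
EulerRecurrence a = ∀ n → ∑ (suc n) (λ j → + (n C j) * a j * cosC (n ∸ j)) ≡ δ₀ n + sinC n

entringer-euler : EulerRecurrence (entringer 0)
entringer-euler n = begin
  ∑ (suc n) (λ j → + (n C j) * entringer 0 j * cosC (n ∸ j))
    ≡⟨ ∑-cong′ (suc n) (λ j → c[1[ab]+0]≡cab (+ (n C j)) (entringer 0 j) (cosC (n ∸ j))) ⟨
  (entringer ⋆ (λ k l → cosC (k ℕ.+ l))) 0 n
    ≡⟨ entringer⋆cos 0 n ⟩
  δ₀ n * + 1 + + 1 * sinC n
    ≡⟨ cong₂ _+_ (*-identityʳ (δ₀ n)) (*-identityˡ (sinC n)) ⟩
  δ₀ n + sinC n ∎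
  where
  open ≡-Reasoning
  c[1[ab]+0]≡cab : ∀ c a b → c * (+ 1 * (a * b) + + 0) ≡ c * a * b
  c[1[ab]+0]≡cab = solve-∀

lookup-∷ʳ-fromℕ : ∀ {n} (xs : Vec ℤ n) x → lookup (xs ∷ʳ x) (fromℕ n) ≡ x
lookup-∷ʳ-fromℕ []       x = refl
lookup-∷ʳ-fromℕ (y ∷ ys) x = lookup-∷ʳ-fromℕ ys x

lookup-∷ʳ-inject₁ : ∀ {n} (xs : Vec ℤ n) x (i : Fin n) → lookup (xs ∷ʳ x) (inject₁ i) ≡ lookup xs i
lookup-∷ʳ-inject₁ (y ∷ ys) x zero    = refl
lookup-∷ʳ-inject₁ (y ∷ ys) x (suc i) = lookup-∷ʳ-inject₁ ys x i

lookup-eulerVec : ∀ n (k : Fin n) → lookup (eulerVec n) k ≡ E (toℕ k)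
lookup-eulerVec (suc n) k with view k
... | ‵fromℕ     = cong E (sym (toℕ-fromℕ n))
... | ‵inject₁ j = trans (lookup-∷ʳ-inject₁ (eulerVec n) _ j)
                         (trans (lookup-eulerVec n j) (cong E (sym (toℕ-inject₁ j))))

sumℤ-tabulate : ∀ n (t : Fin n → ℤ) (f : ℕ → ℤ) → (∀ k → t k ≡ f (toℕ k)) → sumℤ (tabulate t) ≡ ∑ n f
sumℤ-tabulate zero    t f eq = refl
sumℤ-tabulate (suc n) t f eq =
  cong₂ _+_ (eq zero) (sumℤ-tabulate n (λ k → t (suc k)) (λ i → f (suc i)) (λ k → eq (suc k)))

E-recurrence : ∀ n → E n ≡ δ₀ n + sinC n - ∑ n (λ j → + (n C j) * E j * cosC (n ∸ j))
E-recurrence n = trans (lookup-∷ʳ-fromℕ (eulerVec n) _) (cong (_-_ (δ₀ n + sinC n)) (begin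
  sumℤ (map t (allFin n)) ≡⟨ cong sumℤ (map-tabulate (λ k → k) t) ⟩
  sumℤ (tabulate t)
    ≡⟨ sumℤ-tabulate n t _ (λ k → cong (λ e → + (n C toℕ k) * e * cosC (n ∸ toℕ k)) (lookup-eulerVec n k)) ⟩
  ∑ n (λ j → + (n C j) * E j * cosC (n ∸ j)) ∎))
  where
  open ≡-Reasoning
  t : Fin n → ℤ
  t k = + (n C toℕ k) * lookup (eulerVec n) k * cosC (n ∸ toℕ k)

E-unique : ∀ a → EulerRecurrence a → ∀ n → E n ≡ a n
E-unique a rec = <-rec (λ n → E n ≡ a n) step
  where
  step : ∀ n → (∀ {j} → j < n → E j ≡ a j) → E n ≡ a n
  step n ih = begin
    E n
      ≡⟨ E-recurrence n ⟩
    δ₀ n + sinC n - ∑ n (λ j → + (n C j) * E j * cosC (n ∸ j))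
      ≡⟨ cong (_-_ (δ₀ n + sinC n)) (∑-cong n (λ j j<n → cong (λ e → + (n C j) * e * cosC (n ∸ j)) (ih j<n))) ⟩
    δ₀ n + sinC n - S
      ≡⟨ cong (_- S) (rec n) ⟨
    ∑ (suc n) (λ j → + (n C j) * a j * cosC (n ∸ j)) - S
      ≡⟨ cong (_- S) (∑-snoc n (λ j → + (n C j) * a j * cosC (n ∸ j))) ⟩
    S + + (n C n) * a n * cosC (n ∸ n) - S
      ≡⟨ cong (λ x → S + x - S) lastTerm ⟩
    S + a n - S
      ≡⟨ s+x-s≡x S (a n) ⟩
    a n ∎
    where
    open ≡-Reasoning
    S = ∑ n (λ j → + (n C j) * a j * cosC (n ∸ j))
    lastTerm : + (n C n) * a n * cosC (n ∸ n) ≡ a n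
    lastTerm rewrite nCn≡1 n | ℕₚ.n∸n≡0 n = trans (*-identityʳ _) (*-identityˡ (a n))
    s+x-s≡x : ∀ s x → s + x - s ≡ x
    s+x-s≡x = solve-∀

E≡down : ∀ n → E n ≡ down (suc n) (suc n)
E≡down = E-unique (entringer 0) entringer-euler

∑₁-pull : ∀ A B (X : ℕ → ℕ → ℤ) (v : ℕ → ℤ) →
  ∑₁ A (λ a → ∑₁ B (λ h → X a h * v h)) ≡ ∑₁ B (λ h → ∑₁ A (λ a → X a h) * v h)
∑₁-pull A B X v = trans (∑-comm A B (λ i j → X (suc i) (suc j) * v (suc j)))
                        (∑-cong′ B (λ j → sym (∑-* A (λ i → X (suc i) (suc j)) (v (suc j)))))

∑₁-transfer : ∀ A B (w : ℕ → ℤ) (I : ℕ → ℕ → ℤ) (v : ℕ → ℤ) →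
  ∑₁ A (λ c → w c * ∑₁ B (λ h → I c h * v h)) ≡ ∑₁ B (λ h → ∑₁ A (λ c → I c h * w c) * v h)
∑₁-transfer A B w I v = trans
  (∑-cong′ A (λ i → trans (*-∑ B (w (suc i)) (λ j → I (suc i) (suc j) * v (suc j)))
                          (∑-cong′ B (λ j → x*yz≡yx*z (w (suc i)) (I (suc i) (suc j)) (v (suc j))))))
  (∑₁-pull A B (λ c h → I c h * w c) v)

∑₁-up-weighted : ∀ n (w : ℕ → ℤ) → ∑₁ (suc (suc n)) (λ c → w c * up (suc (suc n)) c)
  ≡ ∑₁ (suc n) (λ h → ∑₁ (suc (suc n)) (λ c → [ not (h <ᵇ c) ] * w c) * down (suc n) h)
∑₁-up-weighted n w = trans
  (∑₁-cong (suc (suc n)) (λ c 1≤c c≤n → cong (w c *_) (up-suc n c 1≤c c≤n)))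
  (∑₁-transfer (suc (suc n)) (suc n) w (λ c h → [ not (h <ᵇ c) ]) (down (suc n)))

∑₁-down-weighted : ∀ n (w : ℕ → ℤ) → ∑₁ (suc (suc n)) (λ c → w c * down (suc (suc n)) c)
  ≡ ∑₁ (suc n) (λ h → ∑₁ (suc (suc n)) (λ c → [ h <ᵇ c ] * w c) * up (suc n) h)
∑₁-down-weighted n w = trans
  (∑₁-cong (suc (suc n)) (λ c 1≤c c≤n → cong (w c *_) (down-suc n c 1≤c c≤n)))
  (∑₁-transfer (suc (suc n)) (suc n) w (λ c h → [ h <ᵇ c ]) (up (suc n)))

∑₁-up-complement : ∀ n (w : ℕ → ℤ) →
  ∑₁ (suc n) (λ h → w h * up (suc n) h) ≡ ∑₁ (suc n) (λ h → w (suc (suc n) ∸ h) * down (suc n) h)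
∑₁-up-complement n w = begin
  ∑₁ (suc n) (λ h → w h * up (suc n) h)
    ≡⟨ ∑₁-cong (suc n) (λ h 1≤h h≤n → cong (w h *_) (up≡down-complement n h 1≤h h≤n)) ⟩
  ∑₁ (suc n) (λ h → w h * down (suc n) (suc (suc n) ∸ h))
    ≡⟨ ∑₁-reverse (suc n) (λ h → w h * down (suc n) (suc (suc n) ∸ h)) ⟩
  ∑₁ (suc n) (λ h → w (suc (suc n) ∸ h) * down (suc n) (suc (suc n) ∸ (suc (suc n) ∸ h)))
    ≡⟨ ∑₁-cong (suc n) (λ h _ h≤n → cong (λ x → w (suc (suc n) ∸ h) * down (suc n) x)
                                          (ℕₚ.m∸[m∸n]≡n (ℕₚ.m≤n⇒m≤1+n h≤n))) ⟩
  ∑₁ (suc n) (λ h → w (suc (suc n) ∸ h) * down (suc n) h) ∎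
  where open ≡-Reasoning

tri tet : ℕ → ℤ
tri n = ∑₁ n (λ j → + j)
tet n = ∑₁ n tri

tri-closed : ∀ n → + 2 * tri n ≡ + n * (+ n + + 1)
tri-closed zero    = refl
tri-closed (suc n) = begin
  + 2 * tri (suc n)              ≡⟨ cong (+ 2 *_) (∑-snoc n (λ i → + suc i)) ⟩
  + 2 * (tri n + + suc n)        ≡⟨ *-distribˡ-+ (+ 2) (tri n) (+ suc n) ⟩
  + 2 * tri n + + 2 * + suc n    ≡⟨ cong (_+ + 2 * + suc n) (tri-closed n) ⟩
  + n * (+ n + + 1) + + 2 * (+ 1 + + n) ≡⟨ step (+ n) ⟩
  (+ 1 + + n) * ((+ 1 + + n) + + 1) ∎
  where
  open ≡-Reasoning
  step : ∀ x → x * (x + + 1) + + 2 * (+ 1 + x) ≡ (+ 1 + x) * ((+ 1 + x) + + 1)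
  step = solve-∀

tet-closed : ∀ n → + 6 * tet n ≡ + n * (+ n + + 1) * (+ n + + 2)
tet-closed zero    = refl
tet-closed (suc n) = begin
  + 6 * tet (suc n)                      ≡⟨ cong (+ 6 *_) (∑-snoc n (λ i → tri (suc i))) ⟩
  + 6 * (tet n + tri (suc n))            ≡⟨ 6[x+y]≡6x+3[2y] (tet n) (tri (suc n)) ⟩
  + 6 * tet n + + 3 * (+ 2 * tri (suc n)) ≡⟨ cong₂ (λ x y → x + + 3 * y) (tet-closed n) (tri-closed (suc n)) ⟩
  + n * (+ n + + 1) * (+ n + + 2) + + 3 * ((+ 1 + + n) * ((+ 1 + + n) + + 1)) ≡⟨ step (+ n) ⟩
  (+ 1 + + n) * ((+ 1 + + n) + + 1) * ((+ 1 + + n) + + 2) ∎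
  where
  open ≡-Reasoning
  6[x+y]≡6x+3[2y] : ∀ x y → + 6 * (x + y) ≡ + 6 * x + + 3 * (+ 2 * y)
  6[x+y]≡6x+3[2y] = solve-∀
  step : ∀ x → x * (x + + 1) * (x + + 2) + + 3 * ((+ 1 + x) * ((+ 1 + x) + + 1))
             ≡ (+ 1 + x) * ((+ 1 + x) + + 1) * ((+ 1 + x) + + 2)
  step = solve-∀

∑₁-count-≥ : ∀ M h → h ≤ M → ∑₁ M (λ c → [ not (h <ᵇ c) ]) ≡ + h
∑₁-count-≥ M h h≤M = begin
  ∑₁ M (λ c → [ not (h <ᵇ c) ])           ≡⟨ ∑-cong′ M (λ i → *-identityʳ [ not (h <ᵇ suc i) ]) ⟨
  ∑₁ M (λ c → [ not (h <ᵇ c) ] * + 1)     ≡⟨ ∑₁-restrict-≤ M h h≤M (λ _ → + 1) ⟩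
  ∑₁ h (λ _ → + 1)                        ≡⟨ ∑-const h (+ 1) ⟩
  + h * + 1                               ≡⟨ *-identityʳ (+ h) ⟩
  + h ∎
  where open ≡-Reasoning

∑₁-count-< : ∀ M g → g ≤ M → ∑₁ M (λ b → [ g <ᵇ b ]) ≡ + M - + g
∑₁-count-< M g g≤M = begin
  ∑₁ M (λ b → [ g <ᵇ b ])                ≡⟨ ∑-cong′ M (λ i → *-identityʳ [ g <ᵇ suc i ]) ⟨
  ∑₁ M (λ b → [ g <ᵇ b ] * + 1)          ≡⟨ ∑₁-restrict-> M g g≤M (λ _ → + 1) ⟩
  ∑₁ M (λ _ → + 1) - ∑₁ g (λ _ → + 1)    ≡⟨ cong₂ _-_ (∑-const M (+ 1)) (∑-const g (+ 1)) ⟩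
  + M * + 1 - + g * + 1                  ≡⟨ cong₂ _-_ (*-identityʳ (+ M)) (*-identityʳ (+ g)) ⟩
  + M - + g ∎
  where open ≡-Reasoning

∑₁-linear : ∀ n (K : ℤ) → ∑₁ n (λ a → K - + a) ≡ + n * K - tri n
∑₁-linear n K = trans (∑-- n (λ _ → K) (λ i → + suc i)) (cong (_- tri n) (∑-const n K))

down-diagonal : ∀ n → down (suc (suc n)) (suc (suc n)) ≡ ∑₁ (suc n) (λ h → + 1 * up (suc n) h)
down-diagonal n = trans (down-suc n (suc (suc n)) (s≤s z≤n) ℕₚ.≤-refl)
  (∑₁-cong (suc n) (λ h _ h≤n → cong (λ b → [ b ] * up (suc n) h) (<⇒<ᵇ≡true (s≤s h≤n))))

∑₁-1*up : ∀ n → ∑₁ (suc (suc n)) (λ h → + 1 * up (suc (suc n)) h) ≡ ∑₁ (suc n) (λ g → + g * down (suc n) g)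
∑₁-1*up n = trans (∑₁-up-weighted n (λ _ → + 1)) (∑₁-cong (suc n) (λ g _ g≤n →
  cong (_* down (suc n) g) (trans (∑-cong′ (suc (suc n)) (λ i → *-identityʳ [ not (g <ᵇ suc i) ]))
                                  (∑₁-count-≥ (suc (suc n)) g (ℕₚ.m≤n⇒m≤1+n g≤n)))))

∑₁-id*down : ∀ n → ∑₁ (suc (suc n)) (λ g → + g * down (suc (suc n)) g)
  ≡ ∑₁ (suc n) (λ f → (tri (suc (suc n)) - tri f) * up (suc n) f)
∑₁-id*down n = trans (∑₁-down-weighted n (λ g → + g)) (∑₁-cong (suc n) (λ f _ f≤n →
  cong (_* up (suc n) f) (∑₁-restrict-> (suc (suc n)) f (ℕₚ.m≤n⇒m≤1+n f≤n) (λ g → + g))))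

∑₁-tri*up : ∀ n K → ∑₁ (suc (suc n)) (λ f → (tri K - tri f) * up (suc (suc n)) f)
  ≡ ∑₁ (suc n) (λ e → (+ e * tri K - tet e) * down (suc n) e)
∑₁-tri*up n K = trans (∑₁-up-weighted n (λ f → tri K - tri f)) (∑₁-cong (suc n) (λ e _ e≤n →
  cong (_* down (suc n) e) (begin
    ∑₁ (suc (suc n)) (λ f → [ not (e <ᵇ f) ] * (tri K - tri f))
      ≡⟨ ∑₁-restrict-≤ (suc (suc n)) e (ℕₚ.m≤n⇒m≤1+n e≤n) (λ f → tri K - tri f) ⟩
    ∑₁ e (λ f → tri K - tri f)
      ≡⟨ ∑-- e (λ _ → tri K) (λ i → tri (suc i)) ⟩
    ∑₁ e (λ _ → tri K) - tet e
      ≡⟨ cong (_- tet e) (∑-const e (tri K)) ⟩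
    + e * tri K - tet e ∎)))
  where open ≡-Reasoning

E-via-down₃ : ∀ m → E (3 ℕ.+ m) ≡ ∑₁ (suc m) (λ e → (tri (2 ℕ.+ m) - tri (2 ℕ.+ m ∸ e)) * down (suc m) e)
E-via-down₃ m = begin
  E (3 ℕ.+ m)                                                 ≡⟨ E≡down (3 ℕ.+ m) ⟩
  down (4 ℕ.+ m) (4 ℕ.+ m)                                    ≡⟨ down-diagonal (2 ℕ.+ m) ⟩
  ∑₁ (3 ℕ.+ m) (λ h → + 1 * up (3 ℕ.+ m) h)                  ≡⟨ ∑₁-1*up (suc m) ⟩
  ∑₁ (2 ℕ.+ m) (λ g → + g * down (2 ℕ.+ m) g)                ≡⟨ ∑₁-id*down m ⟩
  ∑₁ (suc m) (λ f → (tri (2 ℕ.+ m) - tri f) * up (suc m) f)  ≡⟨ ∑₁-up-complement m (λ f → tri (2 ℕ.+ m) - tri f) ⟩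
  ∑₁ (suc m) (λ e → (tri (2 ℕ.+ m) - tri (2 ℕ.+ m ∸ e)) * down (suc m) e) ∎
  where open ≡-Reasoning

E-via-down₄ : ∀ m → E (4 ℕ.+ m) ≡ ∑₁ (suc m) (λ e → (+ e * tri (3 ℕ.+ m) - tet e) * down (suc m) e)
E-via-down₄ m = begin
  E (4 ℕ.+ m)                                                 ≡⟨ E≡down (4 ℕ.+ m) ⟩
  down (5 ℕ.+ m) (5 ℕ.+ m)                                    ≡⟨ down-diagonal (3 ℕ.+ m) ⟩
  ∑₁ (4 ℕ.+ m) (λ h → + 1 * up (4 ℕ.+ m) h)                  ≡⟨ ∑₁-1*up (2 ℕ.+ m) ⟩
  ∑₁ (3 ℕ.+ m) (λ g → + g * down (3 ℕ.+ m) g)                ≡⟨ ∑₁-id*down (suc m) ⟩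
  ∑₁ (2 ℕ.+ m) (λ f → (tri (3 ℕ.+ m) - tri f) * up (2 ℕ.+ m) f) ≡⟨ ∑₁-tri*up m (3 ℕ.+ m) ⟩
  ∑₁ (suc m) (λ e → (+ e * tri (3 ℕ.+ m) - tet e) * down (suc m) e) ∎
  where open ≡-Reasoning

cond3412 : ℕ → ℕ → ℕ → ℕ → Bool
cond3412 a b c h = not (b <ᵇ a) ∧ ((suc h <ᵇ a) ∧ not (h <ᵇ c))

pattern3412-standardised : ∀ a b c h r →
  let σ = a ∷ map (punchIn a) (b ∷ map (punchIn b) (c ∷ map (punchIn c) (h ∷ r))) in
  altUp σ ∧ pattern3412 σ ≡ cond3412 a b c h ∧ altDown (h ∷ r)
pattern3412-standardised a b c h r = begin
  _ ≡⟨ cong₂ _∧_ (cong₂ _∧_ a<b′ (cong₂ _∧_ c′<b′ (cong₂ _∧_ c′<h′ tail)))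
                 (cong₂ _∧_ c′<h′ (cong₂ _∧_ h′<a a<b′)) ⟩
  (not (b <ᵇ a) ∧ ((c <ᵇ b) ∧ (not (h <ᵇ c) ∧ altDown (h ∷ r))))
    ∧ (not (h <ᵇ c) ∧ ((punchIn b (punchIn c h) <ᵇ a) ∧ not (b <ᵇ a)))
    ≡⟨ reduce (b <ᵇ a) (c <ᵇ b) (h <ᵇ c) (altDown (h ∷ r)) _ (suc h <ᵇ a) h′<a-reduced c<b ⟩
  cond3412 a b c h ∧ altDown (h ∷ r) ∎
  where
  open ≡-Reasoning
  a<b′ : (a <ᵇ punchIn a b) ≡ not (b <ᵇ a)
  a<b′ = self-<ᵇ-punchIn a b
  c′<b′ : (punchIn a (punchIn b c) <ᵇ punchIn a b) ≡ (c <ᵇ b)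
  c′<b′ = trans (punchIn-<ᵇ a (punchIn b c) b) (punchIn-<ᵇ-self b c)
  c′<h′ : (punchIn a (punchIn b c) <ᵇ punchIn a (punchIn b (punchIn c h))) ≡ not (h <ᵇ c)
  c′<h′ = trans (punchIn-<ᵇ a _ _) (trans (punchIn-<ᵇ b _ _) (self-<ᵇ-punchIn c h))
  tail : altDown (map (punchIn a) (map (punchIn b) (map (punchIn c) (h ∷ r)))) ≡ altDown (h ∷ r)
  tail = trans (altDown-map a (map (punchIn b) (map (punchIn c) (h ∷ r))))
               (trans (altDown-map b (map (punchIn c) (h ∷ r))) (altDown-map c (h ∷ r)))
  h′<a : (punchIn a (punchIn b (punchIn c h)) <ᵇ a) ≡ (punchIn b (punchIn c h) <ᵇ a)
  h′<a = punchIn-<ᵇ-self a _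
  h′<a-reduced : (b <ᵇ a) ≡ false → (h <ᵇ c) ≡ false → (punchIn b (punchIn c h) <ᵇ a) ≡ (suc h <ᵇ a)
  h′<a-reduced b≮a h≮c = trans (punchIn-<ᵇ-≤ (punchIn c h) (<ᵇ≡false⇒≥ b a b≮a))
                              (cong (_<ᵇ a) (punchIn-≥ (<ᵇ≡false⇒≥ h c h≮c)))
  c<b : (b <ᵇ a) ≡ false → (h <ᵇ c) ≡ false → (suc h <ᵇ a) ≡ true → (c <ᵇ b) ≡ true
  c<b b≮a h≮c h+1<a = <⇒<ᵇ≡true (ℕₚ.≤-trans (s≤s (<ᵇ≡false⇒≥ h c h≮c))
                        (ℕₚ.≤-trans (ℕₚ.<⇒≤ (<ᵇ≡true⇒< (suc h) a h+1<a)) (<ᵇ≡false⇒≥ b a b≮a)))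
  reduce : ∀ p q r D X X′ → (p ≡ false → r ≡ false → X ≡ X′) →
           (p ≡ false → r ≡ false → X′ ≡ true → q ≡ true) →
    (not p ∧ (q ∧ (not r ∧ D))) ∧ (not r ∧ (X ∧ not p)) ≡ (not p ∧ (X′ ∧ not r)) ∧ D
  reduce true  q r     D X X′ _   _   = refl
  reduce false q true  D X X′ _   _   = trans (∧-zeroʳ (q ∧ false)) (sym (cong (_∧ D) (∧-zeroʳ X′)))
  reduce false q false D X X′ X≡X′ q≡true rewrite X≡X′ refl refl with X′
  ... | false = ∧-zeroʳ (q ∧ D)
  ... | true rewrite q≡true refl refl refl = ∧-identityʳ D

weight3412 : ℕ → ℕ → ℤ
weight3412 m h = ∑₁ (4 ℕ.+ m) (λ a → ∑₁ (3 ℕ.+ m) (λ b → ∑₁ (2 ℕ.+ m) (λ c → [ cond3412 a b c h ])))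

permCount-3412-prefix : ∀ m a b c h → 1 ≤ h → h ≤ suc m →
  permCount m (λ r → let σ = a ∷ map (punchIn a) (b ∷ map (punchIn b) (c ∷ map (punchIn c) (h ∷ map (punchIn h) r)))
                     in altUp σ ∧ pattern3412 σ)
  ≡ [ cond3412 a b c h ] * down (suc m) h
permCount-3412-prefix m a b c h 1≤h h≤m = begin
  _ ≡⟨ count-cong′ m m (λ r → cong (distinct r ∧_) (pattern3412-standardised a b c h (map (punchIn h) r))) ⟩
  permCount m (λ r → cond3412 a b c h ∧ altDown (h ∷ map (punchIn h) r))
    ≡⟨ permCount-∧ m (cond3412 a b c h) (λ r → altDown (h ∷ map (punchIn h) r)) ⟩
  [ cond3412 a b c h ] * permCount m (λ r → altDown (h ∷ map (punchIn h) r))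
    ≡⟨ cong ([ cond3412 a b c h ] *_) (permCount-startsWith m h 1≤h h≤m altDown) ⟨
  [ cond3412 a b c h ] * down (suc m) h ∎
  where open ≡-Reasoning

numA3412-expand : ∀ m → + numA3412 (4 ℕ.+ m) ≡
  ∑₁ (4 ℕ.+ m) (λ a → ∑₁ (3 ℕ.+ m) (λ b → ∑₁ (2 ℕ.+ m) (λ c → ∑₁ (suc m) (λ h → [ cond3412 a b c h ] * down (suc m) h))))
numA3412-expand m =
  trans (numA3412≡permCount (4 ℕ.+ m)) (
  trans (permCount-suc (3 ℕ.+ m) Q) (∑-cong′ (4 ℕ.+ m) (λ i →
  trans (permCount-suc (2 ℕ.+ m) (λ σ → Q (suc i ∷ map (punchIn (suc i)) σ))) (∑-cong′ (3 ℕ.+ m) (λ j →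
  trans (permCount-suc (suc m) (λ σ → Q (suc i ∷ map (punchIn (suc i)) (suc j ∷ map (punchIn (suc j)) σ))))
        (∑-cong′ (2 ℕ.+ m) (λ k →
  trans (permCount-suc m (λ σ → Q (suc i ∷ map (punchIn (suc i)) (suc j ∷ map (punchIn (suc j))
                                   (suc k ∷ map (punchIn (suc k)) σ)))))
        (∑₁-cong (suc m) (permCount-3412-prefix m (suc i) (suc j) (suc k))))))))))
  where
  Q : List ℕ → Bool
  Q σ = altUp σ ∧ pattern3412 σ

numA3412-via-down : ∀ m → + numA3412 (4 ℕ.+ m) ≡ ∑₁ (suc m) (λ h → weight3412 m h * down (suc m) h)
numA3412-via-down m = begin
  + numA3412 (4 ℕ.+ m)
    ≡⟨ numA3412-expand m ⟩
  ∑₁ (4 ℕ.+ m) (λ a → ∑₁ (3 ℕ.+ m) (λ b → ∑₁ (2 ℕ.+ m) (λ c → ∑₁ (suc m) (λ h → [ cond3412 a b c h ] * D h))))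
    ≡⟨ ∑-cong′ (4 ℕ.+ m) (λ i → ∑-cong′ (3 ℕ.+ m) (λ j →
         ∑₁-pull (2 ℕ.+ m) (suc m) (λ c h → [ cond3412 (suc i) (suc j) c h ]) D)) ⟩
  ∑₁ (4 ℕ.+ m) (λ a → ∑₁ (3 ℕ.+ m) (λ b → ∑₁ (suc m) (λ h → ∑₁ (2 ℕ.+ m) (λ c → [ cond3412 a b c h ]) * D h)))
    ≡⟨ ∑-cong′ (4 ℕ.+ m) (λ i →
         ∑₁-pull (3 ℕ.+ m) (suc m) (λ b h → ∑₁ (2 ℕ.+ m) (λ c → [ cond3412 (suc i) b c h ])) D) ⟩
  ∑₁ (4 ℕ.+ m) (λ a → ∑₁ (suc m) (λ h → ∑₁ (3 ℕ.+ m) (λ b → ∑₁ (2 ℕ.+ m) (λ c → [ cond3412 a b c h ])) * D h))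
    ≡⟨ ∑₁-pull (4 ℕ.+ m) (suc m) (λ a h → ∑₁ (3 ℕ.+ m) (λ b → ∑₁ (2 ℕ.+ m) (λ c → [ cond3412 a b c h ]))) D ⟩
  ∑₁ (suc m) (λ h → weight3412 m h * D h) ∎
  where
  open ≡-Reasoning
  D = down (suc m)

∑c-cond3412 : ∀ m a b h → h ≤ suc m →
  ∑₁ (2 ℕ.+ m) (λ c → [ cond3412 a b c h ]) ≡ [ not (b <ᵇ a) ] * ([ suc h <ᵇ a ] * + h)
∑c-cond3412 m a b h h≤m = begin
  ∑₁ (2 ℕ.+ m) (λ c → [ cond3412 a b c h ])
    ≡⟨ ∑-cong′ (2 ℕ.+ m) (λ i → trans ([∧] (not (b <ᵇ a)) ((suc h <ᵇ a) ∧ not (h <ᵇ suc i)))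
                               (trans (cong ([ not (b <ᵇ a) ] *_) ([∧] (suc h <ᵇ a) (not (h <ᵇ suc i))))
                                      (sym (*-assoc [ not (b <ᵇ a) ] [ suc h <ᵇ a ] [ not (h <ᵇ suc i) ])))) ⟩
  ∑₁ (2 ℕ.+ m) (λ c → [ not (b <ᵇ a) ] * [ suc h <ᵇ a ] * [ not (h <ᵇ c) ])
    ≡⟨ *-∑ (2 ℕ.+ m) ([ not (b <ᵇ a) ] * [ suc h <ᵇ a ]) (λ i → [ not (h <ᵇ suc i) ]) ⟨
  [ not (b <ᵇ a) ] * [ suc h <ᵇ a ] * ∑₁ (2 ℕ.+ m) (λ c → [ not (h <ᵇ c) ])
    ≡⟨ cong ([ not (b <ᵇ a) ] * [ suc h <ᵇ a ] *_) (∑₁-count-≥ (2 ℕ.+ m) h (ℕₚ.m≤n⇒m≤1+n h≤m)) ⟩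
  [ not (b <ᵇ a) ] * [ suc h <ᵇ a ] * + h
    ≡⟨ *-assoc [ not (b <ᵇ a) ] [ suc h <ᵇ a ] (+ h) ⟩
  [ not (b <ᵇ a) ] * ([ suc h <ᵇ a ] * + h) ∎
  where open ≡-Reasoning

∑b∑c-cond3412 : ∀ m a h → 1 ≤ a → a ≤ 4 ℕ.+ m → h ≤ suc m →
  ∑₁ (3 ℕ.+ m) (λ b → ∑₁ (2 ℕ.+ m) (λ c → [ cond3412 a b c h ])) ≡ [ suc h <ᵇ a ] * ((+ (4 ℕ.+ m) - + a) * + h)
∑b∑c-cond3412 m (suc a) h _ (s≤s a≤) h≤m = begin
  ∑₁ (3 ℕ.+ m) (λ b → ∑₁ (2 ℕ.+ m) (λ c → [ cond3412 (suc a) b c h ]))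
    ≡⟨ ∑-cong′ (3 ℕ.+ m) (λ j → ∑c-cond3412 m (suc a) (suc j) h h≤m) ⟩
  ∑₁ (3 ℕ.+ m) (λ b → [ not (b <ᵇ suc a) ] * ([ suc h <ᵇ suc a ] * + h))
    ≡⟨ ∑-* (3 ℕ.+ m) (λ i → [ not (suc i <ᵇ suc a) ]) ([ suc h <ᵇ suc a ] * + h) ⟨
  ∑₁ (3 ℕ.+ m) (λ b → [ not (b <ᵇ suc a) ]) * ([ suc h <ᵇ suc a ] * + h)
    ≡⟨ cong (_* ([ suc h <ᵇ suc a ] * + h))
            (trans (∑-cong′ (3 ℕ.+ m) (λ i → cong [_] (not-<ᵇ-suc a (suc i)))) (∑₁-count-< (3 ℕ.+ m) a a≤)) ⟩
  (+ (3 ℕ.+ m) - + a) * ([ suc h <ᵇ suc a ] * + h)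
    ≡⟨ rearrange (+ (3 ℕ.+ m)) (+ a) [ suc h <ᵇ suc a ] (+ h) ⟩
  [ suc h <ᵇ suc a ] * ((+ (4 ℕ.+ m) - + suc a) * + h) ∎
  where
  open ≡-Reasoning
  rearrange : ∀ M A I H → (M - A) * (I * H) ≡ I * (((+ 1 + M) - (+ 1 + A)) * H)
  rearrange = solve-∀

weight3412-closed : ∀ m h → h ≤ suc m → let K = 4 ℕ.+ m in
  weight3412 m h ≡ (+ K * + K - tri K) * + h - (+ suc h * + K - tri (suc h)) * + h
weight3412-closed m h h≤m = begin
  weight3412 m h
    ≡⟨ ∑₁-cong K (λ a 1≤a a≤K → ∑b∑c-cond3412 m a h 1≤a a≤K h≤m) ⟩
  ∑₁ K (λ a → [ suc h <ᵇ a ] * ((+ K - + a) * + h))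
    ≡⟨ ∑₁-restrict-> K (suc h) (s≤s (ℕₚ.m≤n⇒m≤1+n (ℕₚ.m≤n⇒m≤1+n h≤m))) (λ a → (+ K - + a) * + h) ⟩
  ∑₁ K (λ a → (+ K - + a) * + h) - ∑₁ (suc h) (λ a → (+ K - + a) * + h)
    ≡⟨ cong₂ _-_ (linear K) (linear (suc h)) ⟩
  (+ K * + K - tri K) * + h - (+ suc h * + K - tri (suc h)) * + h ∎
  where
  open ≡-Reasoning
  K = 4 ℕ.+ m
  linear : ∀ n → ∑₁ n (λ a → (+ K - + a) * + h) ≡ (+ n * + K - tri n) * + h
  linear n = trans (sym (∑-* n (λ i → + K - + suc i) (+ h))) (cong (_* + h) (∑₁-linear n (+ K)))

-- The factor 6 clears the denominators of the closed forms of tri and tet.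
weight3412-closed×6 : ∀ e y → let K = suc (suc (e ℕ.+ y)) in
  + 6 * ((+ K * + K - tri K) * + e - (+ suc e * + K - tri (suc e)) * + e) ≡ + 3 * + e * (+ y * (+ y + + 1))
weight3412-closed×6 e y = begin
  + 6 * ((+ K * + K - tri K) * + e - (+ suc e * + K - tri (suc e)) * + e)
    ≡⟨ scale (+ K) (+ e) (tri K) (tri (suc e)) ⟩
  + 6 * + K * + K * + e - + 3 * + e * (+ 2 * tri K) - + 6 * + suc e * + K * + e + + 3 * + e * (+ 2 * tri (suc e))
    ≡⟨ cong₂ (λ x z → + 6 * + K * + K * + e - + 3 * + e * x - + 6 * + suc e * + K * + e + + 3 * + e * z)
             (tri-closed K) (tri-closed (suc e)) ⟩
  + 6 * + K * + K * + e - + 3 * + e * (+ K * (+ K + + 1)) - + 6 * + suc e * + K * + e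
    + + 3 * + e * (+ suc e * (+ suc e + + 1))
    ≡⟨ polynomial (+ e) (+ y) ⟩
  + 3 * + e * (+ y * (+ y + + 1)) ∎
  where
  open ≡-Reasoning
  K = suc (suc (e ℕ.+ y))
  scale : ∀ K E tK t₁ → + 6 * ((K * K - tK) * E - ((+ 1 + E) * K - t₁) * E)
    ≡ + 6 * K * K * E - + 3 * E * (+ 2 * tK) - + 6 * (+ 1 + E) * K * E + + 3 * E * (+ 2 * t₁)
  scale = solve-∀
  polynomial : ∀ E Y → let K = + 2 + (E + Y) in
    + 6 * K * K * E - + 3 * E * (K * (K + + 1)) - + 6 * (+ 1 + E) * K * E + + 3 * E * ((+ 1 + E) * ((+ 1 + E) + + 1))
    ≡ + 3 * E * (Y * (Y + + 1))
  polynomial = solve-∀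

euler-combination×6 : ∀ e y → let s = e ℕ.+ y ; K = suc (suc s) in
  + 6 * (+ 2 * + K * (tri s - tri y) - + 3 * (+ e * tri (suc s) - tet e)) ≡ + 3 * + e * (+ y * (+ y + + 1))
euler-combination×6 e y = begin
  + 6 * (+ 2 * + K * (tri s - tri y) - + 3 * (+ e * tri (suc s) - tet e))
    ≡⟨ scale (+ K) (+ e) (tri s) (tri y) (tri (suc s)) (tet e) ⟩
  + 6 * + K * (+ 2 * tri s) - + 6 * + K * (+ 2 * tri y) - + 9 * + e * (+ 2 * tri (suc s)) + + 3 * (+ 6 * tet e)
    ≡⟨ cong₂ (λ x z → x + + 3 * z)
             (cong₂ (λ x z → x - + 9 * + e * z)
                    (cong₂ (λ x z → + 6 * + K * x - + 6 * + K * z) (tri-closed s) (tri-closed y))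
                    (tri-closed (suc s)))
             (tet-closed e) ⟩
  + 6 * + K * (+ s * (+ s + + 1)) - + 6 * + K * (+ y * (+ y + + 1))
    - + 9 * + e * (+ suc s * (+ suc s + + 1)) + + 3 * (+ e * (+ e + + 1) * (+ e + + 2))
    ≡⟨ polynomial (+ e) (+ y) ⟩
  + 3 * + e * (+ y * (+ y + + 1)) ∎
  where
  open ≡-Reasoning
  s = e ℕ.+ y
  K = suc (suc s)
  scale : ∀ K E tₛ tᵧ tₛ₊₁ τ → + 6 * (+ 2 * K * (tₛ - tᵧ) - + 3 * (E * tₛ₊₁ - τ))
    ≡ + 6 * K * (+ 2 * tₛ) - + 6 * K * (+ 2 * tᵧ) - + 9 * E * (+ 2 * tₛ₊₁) + + 3 * (+ 6 * τ)
  scale = solve-∀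
  polynomial : ∀ E Y → let S = E + Y ; K = + 2 + S in
    + 6 * K * (S * (S + + 1)) - + 6 * K * (Y * (Y + + 1)) - + 9 * E * ((+ 1 + S) * ((+ 1 + S) + + 1))
      + + 3 * (E * (E + + 1) * (E + + 2))
    ≡ + 3 * E * (Y * (Y + + 1))
  polynomial = solve-∀

weight3412≡euler-combination : ∀ m e → e ≤ suc m →
  weight3412 m e ≡ + 2 * + (4 ℕ.+ m) * (tri (2 ℕ.+ m) - tri (2 ℕ.+ m ∸ e)) - + 3 * (+ e * tri (3 ℕ.+ m) - tet e)
weight3412≡euler-combination m e e≤m = trans (weight3412-closed m e e≤m)
  (combine (2 ℕ.+ m ∸ e) (ℕₚ.m+[n∸m]≡n (ℕₚ.m≤n⇒m≤1+n e≤m)))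
  where
  combine : ∀ y {s} → e ℕ.+ y ≡ s → let K = suc (suc s) in
    (+ K * + K - tri K) * + e - (+ suc e * + K - tri (suc e)) * + e
    ≡ + 2 * + K * (tri s - tri y) - + 3 * (+ e * tri (suc s) - tet e)
  combine y refl = *-cancelˡ-≡ (+ 6) _ _ (trans (weight3412-closed×6 e y) (sym (euler-combination×6 e y)))

mainTheorem11 : (n : ℕ) → 4 ≤ n →
    + numA3412 n ≡ (+ 2) * (+ n) * E (n ∸ 1) - (+ 3) * E n
mainTheorem11 (suc (suc (suc (suc m)))) (s≤s (s≤s (s≤s (s≤s _)))) = begin
  + numA3412 (4 ℕ.+ m)
    ≡⟨ numA3412-via-down m ⟩
  ∑₁ (suc m) (λ e → weight3412 m e * D e)
    ≡⟨ ∑₁-cong (suc m) (λ e _ e≤m → cong (_* D e) (weight3412≡euler-combination m e e≤m)) ⟩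
  ∑₁ (suc m) (λ e → (+ 2 * + K * V e - + 3 * W e) * D e)
    ≡⟨ ∑-combination (suc m) (+ 2 * + K) (+ 3) (V ∘ suc) (W ∘ suc) (D ∘ suc) ⟩
  + 2 * + K * ∑₁ (suc m) (λ e → V e * D e) - + 3 * ∑₁ (suc m) (λ e → W e * D e)
    ≡⟨ cong₂ (λ x y → + 2 * + K * x - + 3 * y) (E-via-down₃ m) (E-via-down₄ m) ⟨
  + 2 * + K * E (3 ℕ.+ m) - + 3 * E (4 ℕ.+ m) ∎
  where
  open ≡-Reasoning
  K = 4 ℕ.+ m
  D V W : ℕ → ℤ
  D = down (suc m)
  V e = tri (2 ℕ.+ m) - tri (2 ℕ.+ m ∸ e)
  W e = + e * tri (3 ℕ.+ m) - tet e
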